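{- Let $m\ge1$ and let $Y_m(x,v,z)=\sum_{t\in\mathcal I_{012,m}}\frac{x^{o(t)}v^{r(t)}z^m}{m!}$. Consider the random $0$-$1$-$2$-increasing tree $\rho(T)$ of size $m$, where $T$ is a ranked tree of size $m+1$ generated by the coalescent process. Then: (i) $P_m(r=r')=[v^{r'}]\,Y_m\!\left(\tfrac12,v,2\right)$; (ii) $P_m(o=o',r=r')=[x^{o'}v^{r'}]\,Y_m\!\left(\tfrac x2,v,2\right)$; (iii) whenever $P_m(o=o')>0$, $$P_m(r=r'\mid o=o')=\frac{[x^{o'}v^{r'}]\,Y_m\!\left(\tfrac x2,v,2\right)}{[x^{o'}]\,Y_m\!\left(\tfrac x2,1,2\right)}.$$ Here $o$ and $r$ denote $o(\rho(T))$ and $r(\rho(T))$, and $[\,\cdot\,]$ denotes coefficient extraction in the polynomial.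
   Context: A ranked tree of size $n$ is a rooted binary unordered tree (every node has outdegree $0$ or $2$) with $n$ unlabeled leaves whose $n-1$ internal nodes carry distinct labels from $\{1,\dots,n-1\}$ with every internal child labeled larger than its parent; trees are considered up to label-preserving isomorphism. A $0$-$1$-$2$-increasing tree of size $m$ is a rooted unordered tree with $m$ nodes, each of outdegree $0$, $1$ or $2$, with distinct labels from $\{1,\dots,m\}$ increasing away from the root; $\mathcal I_{012,m}$ is the set of these. The map $\rho$ deletes all leaves (and their incident edges) of a ranked tree of size $m+1$, giving a bijection onto $\mathcal I_{012,m}$. For $t\in\mathcal I_{012,m}$, $o(t)$ is the number of outdegree-$0$ nodes (these correspond to cherries of the ranked tree, i.e. internal nodes with two leaf children) and $r(t)$ is the number of pitchforks, i.e. nodes whose subtree has exactly $2$ nodes (corresponding to internal nodes of the ranked tree whose subtree has exactly $3$ leaves). The coalescent process of size $n$ starts with $n$ lineages and repeatedly merges a uniformly random pair of current lineages until one remains, internal nodes ranked by creation time; known fact (Tajima): it produces a ranked tree $T$ of size $n$ with probability $2^{n-1-c(T)}/(n-1)!$, where $c(T)$ is the number of cherries of $T$. -}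

module Defs where

open import Data.Nat as ℕ using (ℕ; zero; suc; _∸_; _!)
open import Data.Nat.Properties using (_!≢0)
open import Data.Bool using (Bool; true; false; if_then_else_; _∧_; not)
open import Data.List using (List; []; _∷_; _++_; map; concatMap; filter; length; replicate; foldr)
open import Data.Product using (_×_; _,_)
open import Data.Integer using (+_)
open import Data.Rational as ℚ using (ℚ; 0ℚ; 1ℚ; _/_)
open import Relation.Nullary.Decidable using (does)

range : ℕ → ℕ → List ℕ
range a zero = []
range a (suc k) = range a k ++ (if does (a ℕ.≤? k) then k ∷ [] else [])

oneTo : ℕ → List ℕ
oneTo m = range 1 (suc m)

count : {A : Set} → (A → Bool) → List A → ℕ
count p xs = length (filter (λ x → p x Data.Bool.≟ true) xs)

occurrences : ℕ → List ℕ → ℕ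
occurrences i = count (λ j → does (i ℕ.≟ j))

nth : List ℕ → ℕ → ℕ
nth [] _ = 0
nth (x ∷ xs) zero = x
nth (x ∷ xs) (suc k) = nth xs k

_^Q_ : ℚ → ℕ → ℚ
q ^Q zero = 1ℚ
q ^Q suc k = q ℚ.* (q ^Q k)

sumQ : List ℚ → ℚ
sumQ = foldr ℚ._+_ 0ℚ

-- An (unordered, up to isomorphism) increasing tree on labels {1..m} is
-- determined by its parent function: node 1 is the root, and node i
-- (2 ≤ i ≤ m) has a parent p(i) with 1 ≤ p(i) < i.  We encode it as the
-- list [p(2), p(3), ..., p(m)].

parent : List ℕ → ℕ → ℕ
parent ps i = nth ps (i ∸ 2)

parentLists : ℕ → List (List ℕ)
parentLists zero = []
parentLists (suc zero) = [] ∷ []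
parentLists (suc (suc k)) =
  concatMap (λ ps → map (λ p → ps ++ (p ∷ [])) (oneTo (suc k))) (parentLists (suc k))

outdeg : List ℕ → ℕ → ℕ
outdeg ps i = occurrences i ps

is012 : ℕ → List ℕ → Bool
is012 m ps = count (λ i → not (does (outdeg ps i ℕ.≤? 2))) (oneTo m) ℕ.≡ᵇ 0

-- the set I_{012,m}, enumerated without repetition
I012 : ℕ → List (List ℕ)
I012 m = filter (λ ps → is012 m ps Data.Bool.≟ true) (parentLists m)

o : ℕ → List ℕ → ℕ
o m ps = count (λ i → does (outdeg ps i ℕ.≟ 0)) (oneTo m)

ancOrSelf : List ℕ → ℕ → ℕ → ℕ → Bool
ancOrSelf ps zero j i = does (i ℕ.≟ j)
ancOrSelf ps (suc f) j i =
  if does (i ℕ.≟ j) then true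
  else (if does (2 ℕ.≤? j) then ancOrSelf ps f (parent ps j) i else false)

subtreeSize : ℕ → List ℕ → ℕ → ℕ
subtreeSize m ps i = count (λ j → ancOrSelf ps j j i) (oneTo m)

-- r(t): number of pitchforks (nodes whose subtree has exactly 2 nodes)
r : ℕ → List ℕ → ℕ
r m ps = count (λ i → does (subtreeSize m ps i ℕ.≟ 2)) (oneTo m)

-- Polynomials in x, v, z with rational coefficients, as lists of
-- monomials (c , a , b , k) meaning c · x^a · v^b · z^k.

Poly : Set
Poly = List (ℚ × ℕ × ℕ × ℕ)

-- monomial substitution  x ↦ α·x^e₁ , v ↦ β·v^e₂ , z ↦ γ·z^e₃
subst : (ℚ × ℕ) → (ℚ × ℕ) → (ℚ × ℕ) → Poly → Poly
subst (α , e₁) (β , e₂) (γ , e₃) =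
  map (λ { (c , a , b , k) →
    (c ℚ.* (α ^Q a) ℚ.* (β ^Q b) ℚ.* (γ ^Q k)) , e₁ ℕ.* a , e₂ ℕ.* b , e₃ ℕ.* k })

coeff : ℕ → ℕ → ℕ → Poly → ℚ
coeff a b k P = sumQ (map (λ { (c , a' , b' , k') →
  if does (a ℕ.≟ a') ∧ does (b ℕ.≟ b') ∧ does (k ℕ.≟ k') then c else 0ℚ }) P)

Y : ℕ → Poly
Y m = map (λ t → ((+ 1 / (m !)) {{m !≢0}} , o m t , r m t , m)) (I012 m)

Y[x/2,v,2] : ℕ → Poly
Y[x/2,v,2] m = subst (ℚ.½ , 1) (1ℚ , 1) (+ 2 / 1 , 0) (Y m)

Y[1/2,v,2] : ℕ → Poly
Y[1/2,v,2] m = subst (ℚ.½ , 0) (1ℚ , 1) (+ 2 / 1 , 0) (Y m)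

Y[x/2,1,2] : ℕ → Poly
Y[x/2,1,2] m = subst (ℚ.½ , 1) (1ℚ , 0) (+ 2 / 1 , 0) (Y m)

data RT : Set where
  leaf : RT
  node : ℕ → RT → RT → RT

nthT : List RT → ℕ → RT
nthT [] _ = leaf
nthT (x ∷ xs) zero = x
nthT (x ∷ xs) (suc k) = nthT xs k

removeAt : {A : Set} → List A → ℕ → List A
removeAt [] _ = []
removeAt (x ∷ xs) zero = xs
removeAt (x ∷ xs) (suc k) = x ∷ removeAt xs k

pairs : ℕ → List (ℕ × ℕ)
pairs k = concatMap (λ j → map (λ i → (i , j)) (range 0 j)) (range 0 k)

-- merge lineages i < j; with k current lineages the new internal node
-- gets rank k-1 (so the first merge gets rank n-1 and the root rank 1,
-- i.e. ranks are by creation time, increasing away from the root)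
merge : List RT → (ℕ × ℕ) → List RT
merge ls (i , j) =
  node (length ls ∸ 1) (nthT ls i) (nthT ls j) ∷ removeAt (removeAt ls j) i

-- all outcomes of the coalescent, one entry per history (sequence of
-- chosen pairs); every history has the same probability, so the
-- coalescent distribution is the uniform distribution on this list.
run : ℕ → List RT → List RT
run zero ls = ls
run (suc f) ls = concatMap (λ ij → run f (merge ls ij)) (pairs (length ls))

coalescent : ℕ → List RT
coalescent n = run n (replicate (suc n) leaf)

-- ρ: delete the leaves of a ranked tree; the internal nodes, labelled by
-- rank, form the 0-1-2-increasing tree, encoded by its parent list.

edges : RT → List (ℕ × ℕ)
edges leaf = []
edges (node k l r') = here l ++ here r' ++ edges l ++ edges r'
  where
  here : RT → List (ℕ × ℕ)
  here leaf = []
  here (node c _ _) = (c , k) ∷ []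

lookupParent : List (ℕ × ℕ) → ℕ → ℕ
lookupParent [] _ = 0
lookupParent ((c , p) ∷ es) i = if does (c ℕ.≟ i) then p else lookupParent es i

ρ : ℕ → RT → List ℕ
ρ m T = map (lookupParent (edges T)) (range 2 (suc m))

prob : {A : Set} → List A → (A → Bool) → ℚ
prob [] _ = 0ℚ
prob xs@(_ ∷ ys) E = (+ count E xs / suc (length ys))

condProb : {A : Set} → List A → (A → Bool) → (A → Bool) → ℚ
condProb xs E F = prob (filter (λ x → F x Data.Bool.≟ true) xs) E

ρT : ℕ → List (List ℕ)
ρT m = map (ρ m) (coalescent m)

P-r : ℕ → ℕ → ℚ
P-r m r' = prob (ρT m) (λ t → does (r m t ℕ.≟ r'))

P-or : ℕ → ℕ → ℕ → ℚ
P-or m o' r' = prob (ρT m) (λ t → does (o m t ℕ.≟ o') ∧ does (r m t ℕ.≟ r'))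

P-o : ℕ → ℕ → ℚ
P-o m o' = prob (ρT m) (λ t → does (o m t ℕ.≟ o'))

P-r∣o : ℕ → ℕ → ℕ → ℚ
P-r∣o m r' o' = condProb (ρT m) (λ t → does (r m t ℕ.≟ r')) (λ t → does (o m t ℕ.≟ o'))

-- Among the (m + 1)! m! / 2^m histories of the coalescent of size m + 1, exactly (m + 1)! 2^(m ∸ o t) / 2^m end in a
-- tree T with ρ T = t, for each t ∈ I₀₁₂,ₘ; so P(ρ T = t) = 2^(m ∸ o t) / m!, which is the coefficient of
-- x^(o t) v^(r t) in Y_m (x / 2, v, 2), and all three statements follow by summing over t. The first merge of m + 2 leaves always forms a cherry of rank m + 1. Because
-- the coalescent is invariant under permuting its lineages, that cherry may equally be placed on any of the m + 1
-- lineages of the remaining process, and marking a lineage before the process runs is the same as marking a leaf of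
-- its outcome. Marking a leaf whose parent is p attaches the node m + 1 below p in ρ T, and p has 2 ∸ outdeg p leaf
-- children: this is the factor by which the weight 2^(m ∸ o t), written as a product over the nodes, grows.

module Submission where

open import Defs
open import Data.Nat using (ℕ; _≤_)
open import Data.Product using (_×_; Σ)
open import Data.Rational using (ℚ; 0ℚ; _<_; _÷_; NonZero)
open import Relation.Binary.PropositionalEquality using (_≡_)

import Algebra.Properties.CommutativeSemigroup
open import Data.Bool using (Bool; true; false; if_then_else_; _∧_; not)
import Data.Bool
import Data.Bool.Properties as Bool
open import Data.Empty using (⊥; ⊥-elim)
open import Data.List using (List; []; _∷_; _++_; map; concatMap; filter; length; replicate)
import Data.List.Properties as List
open import Data.List.Relation.Binary.Permutation.Propositional as Perm using (_↭_)
import Data.List.Relation.Binary.Permutation.Propositional.Properties as ↭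
open import Data.List.Relation.Binary.Pointwise as Pointwise using (Pointwise; []; _∷_)
open import Data.List.Relation.Unary.All as All using (All; []; _∷_)
import Data.List.Relation.Unary.All.Properties as All
open import Data.Nat as ℕ using (zero; suc; _+_; _*_; _∸_; _^_; _⊔_; _⊓_; z≤n; s≤s; _!; _≡ᵇ_; _<ᵇ_; _≤ᵇ_; pred)
import Data.Nat.Properties as ℕ
open import Data.Nat.Properties using (_!≢0)
open import Data.Nat.Tactic.RingSolver using (solve-∀)
open import Data.Product using (_,_; proj₁; proj₂)
open import Data.Rational as ℚ using (1ℚ; _/_)
import Data.Rational.Properties as ℚ
import Data.Rational.Unnormalised as ℚᵘ
import Data.Rational.Unnormalised.Properties as ℚᵘ
open import Data.Sum using (_⊎_; inj₁; inj₂)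
open import Data.Unit using (⊤; tt)
open import Function using (_∘_; it)
open import Relation.Binary using (tri<; tri≈; tri>)
open import Relation.Binary.PropositionalEquality using (_≢_; refl; sym; trans; cong; cong₂; module ≡-Reasoning)
  renaming (subst to ≡-subst)
open import Relation.Nullary.Decidable using (does)

private
  module +-CS = Algebra.Properties.CommutativeSemigroup ℕ.+-commutativeSemigroup
  module *-CS = Algebra.Properties.CommutativeSemigroup ℕ.*-commutativeSemigroup

∑ : {A : Set} → (A → ℕ) → List A → ℕ
∑ f [] = 0
∑ f (x ∷ xs) = f x + ∑ f xs

∑-++ : {A : Set} (f : A → ℕ) (xs ys : List A) → ∑ f (xs ++ ys) ≡ ∑ f xs + ∑ f ys
∑-++ f [] ys = refl
∑-++ f (x ∷ xs) ys = trans (cong (f x +_) (∑-++ f xs ys)) (sym (ℕ.+-assoc (f x) (∑ f xs) (∑ f ys)))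

∑-map : {A B : Set} (f : B → ℕ) (g : A → B) (xs : List A) → ∑ f (map g xs) ≡ ∑ (f ∘ g) xs
∑-map f g [] = refl
∑-map f g (x ∷ xs) = cong (f (g x) +_) (∑-map f g xs)

∑-concatMap : {A B : Set} (f : B → ℕ) (g : A → List B) (xs : List A) →
  ∑ f (concatMap g xs) ≡ ∑ (λ x → ∑ f (g x)) xs
∑-concatMap f g [] = refl
∑-concatMap f g (x ∷ xs) = trans (∑-++ f (g x) (concatMap g xs)) (cong (∑ f (g x) +_) (∑-concatMap f g xs))

∑-cong : {A : Set} {f g : A → ℕ} → (∀ x → f x ≡ g x) → (xs : List A) → ∑ f xs ≡ ∑ g xs
∑-cong f≗g [] = refl
∑-cong f≗g (x ∷ xs) = cong₂ _+_ (f≗g x) (∑-cong f≗g xs)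

∑-cong-All : {A : Set} {f g : A → ℕ} {xs : List A} → All (λ x → f x ≡ g x) xs → ∑ f xs ≡ ∑ g xs
∑-cong-All [] = refl
∑-cong-All (fx≡gx ∷ eqs) = cong₂ _+_ fx≡gx (∑-cong-All eqs)

∑-+ : {A : Set} (f g : A → ℕ) (xs : List A) → ∑ (λ x → f x + g x) xs ≡ ∑ f xs + ∑ g xs
∑-+ f g [] = refl
∑-+ f g (x ∷ xs) rewrite ∑-+ f g xs = +-CS.interchange (f x) (g x) (∑ f xs) (∑ g xs)

∑-*ˡ : {A : Set} (c : ℕ) (f : A → ℕ) (xs : List A) → ∑ (λ x → c * f x) xs ≡ c * ∑ f xs
∑-*ˡ c f [] = sym (ℕ.*-zeroʳ c)
∑-*ˡ c f (x ∷ xs) rewrite ∑-*ˡ c f xs = sym (ℕ.*-distribˡ-+ c (f x) (∑ f xs))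

∑-*ʳ : {A : Set} (c : ℕ) (f : A → ℕ) (xs : List A) → ∑ (λ x → f x * c) xs ≡ ∑ f xs * c
∑-*ʳ c f xs = trans (∑-cong (λ x → ℕ.*-comm (f x) c) xs) (trans (∑-*ˡ c f xs) (ℕ.*-comm c (∑ f xs)))

∑-zero : {A : Set} (xs : List A) → ∑ (λ _ → 0) xs ≡ 0
∑-zero [] = refl
∑-zero (_ ∷ xs) = ∑-zero xs

∑-const : {A : Set} (c : ℕ) (xs : List A) → ∑ (λ _ → c) xs ≡ length xs * c
∑-const c [] = refl
∑-const c (x ∷ xs) = cong (c +_) (∑-const c xs)

∑-comm : {A B : Set} (f : A → B → ℕ) (xs : List A) (ys : List B) →
  ∑ (λ x → ∑ (f x) ys) xs ≡ ∑ (λ y → ∑ (λ x → f x y) xs) ys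
∑-comm f [] ys = sym (∑-zero ys)
∑-comm f (x ∷ xs) ys =
  trans (cong (∑ (f x) ys +_) (∑-comm f xs ys)) (sym (∑-+ (f x) (λ y → ∑ (λ x' → f x' y) xs) ys))

length≡∑1 : {A : Set} (xs : List A) → length xs ≡ ∑ (λ _ → 1) xs
length≡∑1 [] = refl
length≡∑1 (x ∷ xs) = cong suc (length≡∑1 xs)

χ : Bool → ℕ
χ true = 1
χ false = 0

χ-∧ : ∀ a b → χ (a ∧ b) ≡ χ a * χ b
χ-∧ true b = sym (ℕ.+-identityʳ (χ b))
χ-∧ false b = refl

count≡∑χ : {A : Set} (p : A → Bool) (xs : List A) → count p xs ≡ ∑ (χ ∘ p) xs
count≡∑χ p [] = refl
count≡∑χ p (x ∷ xs) with p x
... | true = cong suc (count≡∑χ p xs)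
... | false = count≡∑χ p xs

∑-filter : {A : Set} (f : A → ℕ) (p : A → Bool) (xs : List A) →
  ∑ f (filter (λ x → p x Data.Bool.≟ true) xs) ≡ ∑ (λ x → χ (p x) * f x) xs
∑-filter f p [] = refl
∑-filter f p (x ∷ xs) with p x
... | true = cong₂ _+_ (sym (ℕ.+-identityʳ (f x))) (∑-filter f p xs)
... | false = ∑-filter f p xs

data ≡ᵇ-View (m n : ℕ) : Bool → Set where
  equal : m ≡ n → ≡ᵇ-View m n true
  different : m ≢ n → ≡ᵇ-View m n false

≡ᵇ-view : ∀ m n → ≡ᵇ-View m n (m ≡ᵇ n)
≡ᵇ-view zero zero = equal refl
≡ᵇ-view zero (suc n) = different (λ ())
≡ᵇ-view (suc m) zero = different (λ ())
≡ᵇ-view (suc m) (suc n) with m ≡ᵇ n | ≡ᵇ-view m n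
... | .true | equal m≡n = equal (cong suc m≡n)
... | .false | different m≢n = different (m≢n ∘ ℕ.suc-injective)

≡ᵇ-refl : ∀ n → (n ≡ᵇ n) ≡ true
≡ᵇ-refl zero = refl
≡ᵇ-refl (suc n) = ≡ᵇ-refl n

≢⇒≡ᵇ≡false : ∀ {m n} → m ≢ n → (m ≡ᵇ n) ≡ false
≢⇒≡ᵇ≡false {m} {n} m≢n with m ≡ᵇ n | ≡ᵇ-view m n
... | .true | equal m≡n = ⊥-elim (m≢n m≡n)
... | .false | different _ = refl

<⇒≡ᵇ≡false : ∀ {m n} → m ℕ.< n → (m ≡ᵇ n) ≡ false
<⇒≡ᵇ≡false m<n = ≢⇒≡ᵇ≡false (ℕ.<⇒≢ m<n)

≡ᵇ-sym : ∀ m n → (m ≡ᵇ n) ≡ (n ≡ᵇ m)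
≡ᵇ-sym zero zero = refl
≡ᵇ-sym zero (suc n) = refl
≡ᵇ-sym (suc m) zero = refl
≡ᵇ-sym (suc m) (suc n) = ≡ᵇ-sym m n

<⇒<ᵇ≡true : ∀ {m n} → m ℕ.< n → (m <ᵇ n) ≡ true
<⇒<ᵇ≡true {zero} {suc n} _ = refl
<⇒<ᵇ≡true {suc m} {suc n} (s≤s m<n) = <⇒<ᵇ≡true m<n

≤⇒<ᵇ≡false : ∀ {m n} → n ≤ m → (m <ᵇ n) ≡ false
≤⇒<ᵇ≡false {m} {zero} _ = refl
≤⇒<ᵇ≡false {suc m} {suc n} (s≤s n≤m) = ≤⇒<ᵇ≡false n≤m

∑< : ℕ → (ℕ → ℕ) → ℕ
∑< n f = ∑ f (range 0 n)

∑<-suc : ∀ n f → ∑< (suc n) f ≡ ∑< n f + f n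
∑<-suc n f = trans (∑-++ f (range 0 n) (n ∷ [])) (cong (∑< n f +_) (ℕ.+-identityʳ (f n)))

∑<-suc-shift : ∀ n f → ∑< (suc n) f ≡ f 0 + ∑< n (f ∘ suc)
∑<-suc-shift zero f = refl
∑<-suc-shift (suc n) f = begin
    ∑< (suc (suc n)) f                ≡⟨ ∑<-suc (suc n) f ⟩
    ∑< (suc n) f + f (suc n)          ≡⟨ cong (_+ f (suc n)) (∑<-suc-shift n f) ⟩
    f 0 + ∑< n (f ∘ suc) + f (suc n)  ≡⟨ ℕ.+-assoc (f 0) _ _ ⟩
    f 0 + (∑< n (f ∘ suc) + f (suc n)) ≡⟨ cong (f 0 +_) (sym (∑<-suc n (f ∘ suc))) ⟩
    f 0 + ∑< (suc n) (f ∘ suc)        ∎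
  where open ≡-Reasoning

∑<-cong : ∀ n {f g} → (∀ i → i ℕ.< n → f i ≡ g i) → ∑< n f ≡ ∑< n g
∑<-cong zero f≗g = refl
∑<-cong (suc n) {f} {g} f≗g = begin
    ∑< (suc n) f ≡⟨ ∑<-suc n f ⟩
    ∑< n f + f n ≡⟨ cong₂ _+_ (∑<-cong n (λ i i<n → f≗g i (ℕ.m<n⇒m<1+n i<n))) (f≗g n (ℕ.n<1+n n)) ⟩
    ∑< n g + g n ≡⟨ sym (∑<-suc n g) ⟩
    ∑< (suc n) g ∎
  where open ≡-Reasoning

range-< : ∀ a n → All (ℕ._< n) (range a n)
range-< a zero = []
range-< a (suc n) with does (a ℕ.≤? n)
... | true = All.++⁺ (All.map ℕ.m<n⇒m<1+n (range-< a n)) (ℕ.n<1+n n ∷ [])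
... | false = All.++⁺ (All.map ℕ.m<n⇒m<1+n (range-< a n)) []

range-≥ : ∀ a n → All (a ≤_) (range a n)
range-≥ a zero = []
range-≥ a (suc n) with a ≤ᵇ n in a≤ᵇn
... | true = All.++⁺ (range-≥ a n) (ℕ.≤ᵇ⇒≤ a n (≡-subst Data.Bool.T (sym a≤ᵇn) _) ∷ [])
... | false = All.++⁺ (range-≥ a n) []

length-range0 : ∀ n → length (range 0 n) ≡ n
length-range0 zero = refl
length-range0 (suc n) = trans (List.length-++ (range 0 n)) (trans (cong (_+ 1) (length-range0 n)) (ℕ.+-comm n 1))

oneTo-bounds : ∀ m → All (λ p → 1 ≤ p × p ≤ m) (oneTo m)
oneTo-bounds m = All.zipWith (λ (1≤p , p<1+m) → 1≤p , ℕ.<⇒≤pred p<1+m) (range-≥ 1 (suc m) , range-< 1 (suc m))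

length-oneTo : ∀ m → length (oneTo m) ≡ m
length-oneTo zero = refl
length-oneTo (suc m) = trans (List.length-++ (oneTo m)) (trans (cong (_+ 1) (length-oneTo m)) (ℕ.+-comm m 1))

∑-pairs : (f : ℕ × ℕ → ℕ) (n : ℕ) → ∑ f (pairs n) ≡ ∑< n (λ j → ∑< j (λ i → f (i , j)))
∑-pairs f n = trans (∑-concatMap f _ (range 0 n)) (∑-cong (λ j → ∑-map f (λ i → (i , j)) (range 0 j)) (range 0 n))

pairs-ordered : ∀ n → All (λ (i , j) → i ℕ.< j × j ℕ.< n) (pairs n)
pairs-ordered n = All.concat⁺ (All.map⁺ (All.map column (range-< 0 n)))
  where
  column : ∀ {j} → j ℕ.< n → All (λ (i , j) → i ℕ.< j × j ℕ.< n) (map (λ i → (i , j)) (range 0 j))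
  column {j} j<n = All.map⁺ (All.map (_, j<n) (range-< 0 j))

2*∑<-id : ∀ n → 2 * ∑< n (λ j → j) ≡ n * pred n
2*∑<-id zero = refl
2*∑<-id (suc n) = begin
    2 * ∑< (suc n) (λ j → j)    ≡⟨ cong (2 *_) (∑<-suc n (λ j → j)) ⟩
    2 * (∑< n (λ j → j) + n)    ≡⟨ ℕ.*-distribˡ-+ 2 (∑< n (λ j → j)) n ⟩
    2 * ∑< n (λ j → j) + 2 * n  ≡⟨ cong (_+ 2 * n) (2*∑<-id n) ⟩
    n * pred n + 2 * n          ≡⟨ step n ⟩
    suc n * n                   ∎
  where
  open ≡-Reasoning
  step : ∀ n → n * pred n + 2 * n ≡ suc n * n
  step zero = refl
  step (suc n) = polynomial n
    where
    polynomial : ∀ n → suc n * n + 2 * suc n ≡ suc (suc n) * suc n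
    polynomial = solve-∀

2*length-pairs : ∀ n → 2 * length (pairs n) ≡ n * pred n
2*length-pairs n = trans (cong (2 *_) length≡∑<) (2*∑<-id n)
  where
  length≡∑< : length (pairs n) ≡ ∑< n (λ j → j)
  length≡∑< = trans (length≡∑1 (pairs n)) (trans (∑-pairs (λ _ → 1) n)
    (∑<-cong n (λ j _ → trans (∑-const 1 (range 0 j)) (trans (ℕ.*-identityʳ _) (length-range0 j)))))

nthT-removeAt-< : ∀ ls i j → j ℕ.< i → nthT (removeAt ls i) j ≡ nthT ls j
nthT-removeAt-< [] i j _ = refl
nthT-removeAt-< (x ∷ ls) (suc i) zero _ = refl
nthT-removeAt-< (x ∷ ls) (suc i) (suc j) (s≤s j<i) = nthT-removeAt-< ls i j j<i

nthT-removeAt-≥ : ∀ ls i j → i ≤ j → nthT (removeAt ls i) j ≡ nthT ls (suc j)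
nthT-removeAt-≥ [] i j _ = refl
nthT-removeAt-≥ (x ∷ ls) zero j _ = refl
nthT-removeAt-≥ (x ∷ ls) (suc i) (suc j) (s≤s i≤j) = nthT-removeAt-≥ ls i j i≤j

removeAt-removeAt : {A : Set} (ls : List A) (i j : ℕ) → i ≤ j →
  removeAt (removeAt ls i) j ≡ removeAt (removeAt ls (suc j)) i
removeAt-removeAt [] i j _ = refl
removeAt-removeAt (x ∷ ls) zero j _ = refl
removeAt-removeAt (x ∷ ls) (suc i) (suc j) (s≤s i≤j) = cong (x ∷_) (removeAt-removeAt ls i j i≤j)

length-removeAt : {A : Set} (ls : List A) (i : ℕ) → i ℕ.< length ls → length (removeAt ls i) ≡ pred (length ls)
length-removeAt (x ∷ ls) zero _ = refl
length-removeAt (x ∷ y ∷ ls) (suc i) (s≤s i<) = cong suc (length-removeAt (y ∷ ls) i i<)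

removeAt-map : {A B : Set} (f : A → B) (ls : List A) (i : ℕ) → removeAt (map f ls) i ≡ map f (removeAt ls i)
removeAt-map f [] i = refl
removeAt-map f (x ∷ ls) zero = refl
removeAt-map f (x ∷ ls) (suc i) = cong (f x ∷_) (removeAt-map f ls i)

∑-removeAt : (f : RT → ℕ) → f leaf ≡ 0 → (ls : List RT) (i : ℕ) → ∑ f ls ≡ f (nthT ls i) + ∑ f (removeAt ls i)
∑-removeAt f f-leaf [] i = sym (cong (_+ 0) f-leaf)
∑-removeAt f f-leaf (x ∷ ls) zero = refl
∑-removeAt f f-leaf (x ∷ ls) (suc i) = begin
    f x + ∑ f ls                                 ≡⟨ cong (f x +_) (∑-removeAt f f-leaf ls i) ⟩
    f x + (f (nthT ls i) + ∑ f (removeAt ls i))  ≡⟨ +-CS.x∙yz≈y∙xz (f x) (f (nthT ls i)) _ ⟩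
    f (nthT ls i) + (f x + ∑ f (removeAt ls i))  ∎
  where open ≡-Reasoning

All-nthT : ∀ {P : RT → Set} → P leaf → ∀ {ls} → All P ls → ∀ i → P (nthT ls i)
All-nthT P-leaf [] i = P-leaf
All-nthT P-leaf (px ∷ pxs) zero = px
All-nthT P-leaf (px ∷ pxs) (suc i) = All-nthT P-leaf pxs i

All-removeAt : ∀ {A : Set} {P : A → Set} {ls} → All P ls → ∀ i → All P (removeAt ls i)
All-removeAt [] i = []
All-removeAt (px ∷ pxs) zero = pxs
All-removeAt (px ∷ pxs) (suc i) = px ∷ All-removeAt pxs i

-- Position j of `removeAt ls i` is position `punchIn i j` of ls, as for `Data.Fin.punchIn`.
punchIn : ℕ → ℕ → ℕ
punchIn i j = if j <ᵇ i then j else suc j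

zeroAt : ℕ → (ℕ → ℕ) → ℕ → ℕ
zeroAt i H j = if i ≡ᵇ j then 0 else H j

zeroAt-≢ : ∀ {i j} H → i ≢ j → zeroAt i H j ≡ H j
zeroAt-≢ {i} {j} H i≢j rewrite ≢⇒≡ᵇ≡false i≢j = refl

∑<-punchIn : ∀ N i H → i ≤ N → ∑< N (H ∘ punchIn i) ≡ ∑< (suc N) (zeroAt i H)
∑<-punchIn zero zero H z≤n = refl
∑<-punchIn (suc N) i H i≤1+N with ℕ.m≤n⇒m<n∨m≡n i≤1+N
... | inj₁ (s≤s i≤N) = begin
    ∑< (suc N) (H ∘ punchIn i)              ≡⟨ ∑<-suc N (H ∘ punchIn i) ⟩
    ∑< N (H ∘ punchIn i) + H (punchIn i N)  ≡⟨ cong₂ _+_ (∑<-punchIn N i H i≤N) (cong H punchIn-last) ⟩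
    ∑< (suc N) (zeroAt i H) + H (suc N)     ≡⟨ cong (∑< (suc N) (zeroAt i H) +_) (sym (zeroAt-≢ H (ℕ.<⇒≢ (s≤s i≤N)))) ⟩
    ∑< (suc N) (zeroAt i H) + zeroAt i H (suc N) ≡⟨ sym (∑<-suc (suc N) (zeroAt i H)) ⟩
    ∑< (suc (suc N)) (zeroAt i H)           ∎
  where
  open ≡-Reasoning
  punchIn-last : punchIn i N ≡ suc N
  punchIn-last rewrite ≤⇒<ᵇ≡false i≤N = refl
... | inj₂ refl = begin
    ∑< (suc N) (H ∘ punchIn (suc N))  ≡⟨ ∑<-cong (suc N) (λ j j<i → cong H (punchIn-below j j<i)) ⟩
    ∑< (suc N) H                      ≡⟨ ∑<-cong (suc N) (λ j j<i → sym (zeroAt-≢ H (ℕ.>⇒≢ j<i))) ⟩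
    ∑< (suc N) (zeroAt (suc N) H)     ≡⟨ sym (ℕ.+-identityʳ _) ⟩
    ∑< (suc N) (zeroAt (suc N) H) + 0 ≡⟨ cong (∑< (suc N) (zeroAt (suc N) H) +_) (sym zeroAt-self) ⟩
    ∑< (suc N) (zeroAt (suc N) H) + zeroAt (suc N) H (suc N) ≡⟨ sym (∑<-suc (suc N) (zeroAt (suc N) H)) ⟩
    ∑< (suc (suc N)) (zeroAt (suc N) H) ∎
  where
  open ≡-Reasoning
  punchIn-below : ∀ j → j ℕ.< suc N → punchIn (suc N) j ≡ j
  punchIn-below j j<i rewrite <⇒<ᵇ≡true j<i = refl
  zeroAt-self : zeroAt (suc N) H (suc N) ≡ 0
  zeroAt-self rewrite ≡ᵇ-refl N = refl

∑<-truncate : ∀ n j h → j ≤ n → ∑< n (λ i → if i <ᵇ j then h i else 0) ≡ ∑< j h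
∑<-truncate zero zero h z≤n = refl
∑<-truncate (suc n) j h j≤1+n with ℕ.m≤n⇒m<n∨m≡n j≤1+n
... | inj₁ (s≤s j≤n) =
  trans (∑<-suc n _) (trans (cong₂ _+_ (∑<-truncate n j h j≤n) last-vanishes) (ℕ.+-identityʳ _))
  where
  last-vanishes : (if n <ᵇ j then h n else 0) ≡ 0
  last-vanishes rewrite ≤⇒<ᵇ≡false j≤n = refl
... | inj₂ refl = ∑<-cong (suc n) below
  where
  below : ∀ i → i ℕ.< suc n → (if i <ᵇ suc n then h i else 0) ≡ h i
  below i i<j rewrite <⇒<ᵇ≡true i<j = refl

-- Unordered pairs counted by ordered picks

picks : {A : Set} → List A → List (A × List A)
picks [] = []
picks (a ∷ as) = (a , as) ∷ map (λ (x , r) → x , a ∷ r) (picks as)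

∑picks : {A : Set} → (A → List A → ℕ) → List A → ℕ
∑picks H ls = ∑ (λ (x , r) → H x r) (picks ls)

∑picks-∷ : {A : Set} (H : A → List A → ℕ) (a : A) (as : List A) →
  ∑picks H (a ∷ as) ≡ H a as + ∑picks (λ x r → H x (a ∷ r)) as
∑picks-∷ H a as = cong (H a as +_) (∑-map (λ (x , r) → H x r) (λ (x , r) → x , a ∷ r) (picks as))

∑picks-cong : {A : Set} {H H' : A → List A → ℕ} → (∀ x r → H x r ≡ H' x r) → ∀ ls → ∑picks H ls ≡ ∑picks H' ls
∑picks-cong H≗H' ls = ∑-cong (λ (x , r) → H≗H' x r) (picks ls)

∑picks-+ : {A : Set} (H₁ H₂ : A → List A → ℕ) (ls : List A) →
  ∑picks (λ x r → H₁ x r + H₂ x r) ls ≡ ∑picks H₁ ls + ∑picks H₂ ls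
∑picks-+ H₁ H₂ ls = ∑-+ (λ (x , r) → H₁ x r) (λ (x , r) → H₂ x r) (picks ls)

picks-All : ∀ {A : Set} {P : A → Set} {ls} → All P ls →
  All (λ (x , r) → P x × All P r × length ls ≡ suc (length r)) (picks ls)
picks-All {ls = []} [] = []
picks-All {P = P} {ls = a ∷ as} (pa ∷ pas) = (pa , pas , refl) ∷ All.map⁺ (All.map extend (picks-All pas))
  where
  extend : ∀ {(x , r) : _ × List _} → P x × All P r × length as ≡ suc (length r) →
    P x × All P (a ∷ r) × suc (length as) ≡ suc (length (a ∷ r))
  extend (px , pr , eq) = px , pa ∷ pr , cong suc eq

∑picks-nthT : ∀ (H : RT → List RT → ℕ) ls → ∑picks H ls ≡ ∑< (length ls) (λ i → H (nthT ls i) (removeAt ls i))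
∑picks-nthT H [] = refl
∑picks-nthT H (a ∷ as) = begin
    ∑picks H (a ∷ as)                      ≡⟨ ∑picks-∷ H a as ⟩
    H a as + ∑picks (λ x r → H x (a ∷ r)) as ≡⟨ cong (H a as +_) (∑picks-nthT (λ x r → H x (a ∷ r)) as) ⟩
    H a as + ∑< (length as) (λ i → H (nthT as i) (a ∷ removeAt as i))
      ≡⟨ sym (∑<-suc-shift (length as) (λ i → H (nthT (a ∷ as) i) (removeAt (a ∷ as) i))) ⟩
    ∑< (length (a ∷ as)) (λ i → H (nthT (a ∷ as) i) (removeAt (a ∷ as) i)) ∎
  where open ≡-Reasoning

∑joins : (List RT → ℕ) → ℕ → List RT → ℕ
∑joins G k = ∑picks (λ x r → ∑picks (λ y r' → G (node k x y ∷ r')) r)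

module _ (G : List RT → ℕ) (G-swap : ∀ k x y r → G (node k x y ∷ r) ≡ G (node k y x ∷ r)) (ls : List RT) where

  private
    n = length ls
    k = length ls ∸ 1

    joinAt : ℕ → ℕ → ℕ
    joinAt i j = G (node k (nthT ls i) (nthT ls j) ∷ removeAt (removeAt ls (i ⊔ j)) (i ⊓ j))

    joinAt-sym : ∀ i j → joinAt i j ≡ joinAt j i
    joinAt-sym i j rewrite ℕ.⊔-comm i j | ℕ.⊓-comm i j = G-swap k (nthT ls i) (nthT ls j) _

    joinAt-merge : ∀ i j → i ℕ.< j → joinAt i j ≡ G (merge ls (i , j))
    joinAt-merge i j i<j rewrite ℕ.m≤n⇒m⊔n≡n (ℕ.<⇒≤ i<j) | ℕ.m≤n⇒m⊓n≡m (ℕ.<⇒≤ i<j) = refl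

    joinAfterRemoving : ℕ → ℕ → ℕ
    joinAfterRemoving i j = G (node k (nthT ls i) (nthT (removeAt ls i) j) ∷ removeAt (removeAt ls i) j)

    joinAfterRemoving≡joinAt : ∀ i j → joinAfterRemoving i j ≡ joinAt i (punchIn i j)
    joinAfterRemoving≡joinAt i j with ℕ.<-cmp j i
    ... | tri< j<i _ _
      rewrite <⇒<ᵇ≡true j<i | ℕ.m≥n⇒m⊔n≡m (ℕ.<⇒≤ j<i) | ℕ.m≥n⇒m⊓n≡n (ℕ.<⇒≤ j<i)
            | nthT-removeAt-< ls i j j<i = refl
    ... | tri≈ _ refl _
      rewrite ≤⇒<ᵇ≡false {i} {i} ℕ.≤-refl | ℕ.m≤n⇒m⊔n≡n (ℕ.n≤1+n i) | ℕ.m≤n⇒m⊓n≡m (ℕ.n≤1+n i)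
            | nthT-removeAt-≥ ls i i ℕ.≤-refl | removeAt-removeAt ls i i ℕ.≤-refl = refl
    ... | tri> _ _ i<j
      rewrite ≤⇒<ᵇ≡false (ℕ.<⇒≤ i<j) | ℕ.m≤n⇒m⊔n≡n (ℕ.m≤n⇒m≤1+n (ℕ.<⇒≤ i<j))
            | ℕ.m≤n⇒m⊓n≡m (ℕ.m≤n⇒m≤1+n (ℕ.<⇒≤ i<j))
            | nthT-removeAt-≥ ls i j (ℕ.<⇒≤ i<j) | removeAt-removeAt ls i j (ℕ.<⇒≤ i<j) = refl

    joinBelow : ℕ → ℕ → ℕ
    joinBelow i j = if i <ᵇ j then joinAt i j else 0

    zeroAt-joinAt : ∀ i j → zeroAt i (joinAt i) j ≡ joinBelow i j + joinBelow j i
    zeroAt-joinAt i j with ℕ.<-cmp i j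
    ... | tri< i<j _ _ rewrite <⇒≡ᵇ≡false i<j | <⇒<ᵇ≡true i<j | ≤⇒<ᵇ≡false (ℕ.<⇒≤ i<j) = sym (ℕ.+-identityʳ _)
    ... | tri≈ _ refl _ rewrite ≡ᵇ-refl i | ≤⇒<ᵇ≡false {i} {i} ℕ.≤-refl = refl
    ... | tri> _ _ j<i rewrite ≢⇒≡ᵇ≡false (ℕ.>⇒≢ j<i) | <⇒<ᵇ≡true j<i | ≤⇒<ᵇ≡false (ℕ.<⇒≤ j<i) = joinAt-sym i j

    open ≡-Reasoning

    ∑joins≡∑<∑<zeroAt : ∑joins G k ls ≡ ∑< n (λ i → ∑< n (zeroAt i (joinAt i)))
    ∑joins≡∑<∑<zeroAt = begin
        ∑joins G k ls
          ≡⟨ ∑picks-nthT _ ls ⟩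
        ∑< n (λ i → ∑picks (λ y r' → G (node k (nthT ls i) y ∷ r')) (removeAt ls i))
          ≡⟨ ∑-cong (λ i → ∑picks-nthT _ (removeAt ls i)) (range 0 n) ⟩
        ∑< n (λ i → ∑< (length (removeAt ls i)) (joinAfterRemoving i))
          ≡⟨ ∑<-cong n inner ⟩
        ∑< n (λ i → ∑< n (zeroAt i (joinAt i))) ∎
      where
      inner : ∀ i → i ℕ.< n → ∑< (length (removeAt ls i)) (joinAfterRemoving i) ≡ ∑< n (zeroAt i (joinAt i))
      inner i i<n rewrite length-removeAt ls i i<n = lemma n i<n
        where
        lemma : ∀ m → i ℕ.< m → ∑< (pred m) (joinAfterRemoving i) ≡ ∑< m (zeroAt i (joinAt i))
        lemma (suc m) i<1+m = trans (∑-cong (joinAfterRemoving≡joinAt i) (range 0 m)) (∑<-punchIn m i (joinAt i) (ℕ.<⇒≤pred i<1+m))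

    ∑<∑<joinBelow : ℕ
    ∑<∑<joinBelow = ∑< n (λ i → ∑< n (joinBelow i))

    ∑<∑<zeroAt≡2*∑<∑<joinBelow : ∑< n (λ i → ∑< n (zeroAt i (joinAt i))) ≡ 2 * ∑<∑<joinBelow
    ∑<∑<zeroAt≡2*∑<∑<joinBelow = begin
        ∑< n (λ i → ∑< n (zeroAt i (joinAt i)))
          ≡⟨ ∑-cong (λ i → ∑-cong (zeroAt-joinAt i) (range 0 n)) (range 0 n) ⟩
        ∑< n (λ i → ∑< n (λ j → joinBelow i j + joinBelow j i))
          ≡⟨ ∑-cong (λ i → ∑-+ (joinBelow i) (λ j → joinBelow j i) (range 0 n)) (range 0 n) ⟩
        ∑< n (λ i → ∑< n (joinBelow i) + ∑< n (λ j → joinBelow j i))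
          ≡⟨ ∑-+ _ _ (range 0 n) ⟩
        ∑<∑<joinBelow + ∑< n (λ i → ∑< n (λ j → joinBelow j i))
          ≡⟨ cong (∑<∑<joinBelow +_) (∑-comm (λ i j → joinBelow j i) (range 0 n) (range 0 n)) ⟩
        ∑<∑<joinBelow + ∑<∑<joinBelow
          ≡⟨ cong (∑<∑<joinBelow +_) (sym (ℕ.+-identityʳ ∑<∑<joinBelow)) ⟩
        2 * ∑<∑<joinBelow
          ∎

    ∑<∑<joinBelow≡∑merge : ∑<∑<joinBelow ≡ ∑ (λ ij → G (merge ls ij)) (pairs n)
    ∑<∑<joinBelow≡∑merge = begin
        ∑<∑<joinBelow
          ≡⟨ ∑-comm joinBelow (range 0 n) (range 0 n) ⟩
        ∑< n (λ j → ∑< n (λ i → joinBelow i j))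
          ≡⟨ ∑<-cong n (λ j j<n → ∑<-truncate n j (λ i → joinAt i j) (ℕ.<⇒≤ j<n)) ⟩
        ∑< n (λ j → ∑< j (λ i → joinAt i j))
          ≡⟨ ∑-cong (λ j → ∑<-cong j (λ i i<j → joinAt-merge i j i<j)) (range 0 n) ⟩
        ∑< n (λ j → ∑< j (λ i → G (merge ls (i , j))))
          ≡⟨ sym (∑-pairs (λ ij → G (merge ls ij)) n) ⟩
        ∑ (λ ij → G (merge ls ij)) (pairs n) ∎

  2*∑merge≡∑joins : 2 * ∑ (λ ij → G (merge ls ij)) (pairs (length ls)) ≡ ∑joins G (length ls ∸ 1) ls
  2*∑merge≡∑joins = sym (trans ∑joins≡∑<∑<zeroAt
    (trans ∑<∑<zeroAt≡2*∑<∑<joinBelow (cong (2 *_) ∑<∑<joinBelow≡∑merge)))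

infix 4 _≈_
data _≈_ : RT → RT → Set where
  leaf≈ : leaf ≈ leaf
  node≈ : ∀ {k a b a' b'} → a ≈ a' → b ≈ b' → node k a b ≈ node k a' b'
  swap≈ : ∀ {k a b a' b'} → a ≈ a' → b ≈ b' → node k a b ≈ node k b' a'

≈-refl : ∀ T → T ≈ T
≈-refl leaf = leaf≈
≈-refl (node k l r) = node≈ (≈-refl l) (≈-refl r)

≈-Invariant : (RT → ℕ) → Set
≈-Invariant w = ∀ {x y} → x ≈ y → w x ≡ w y

Pointwise-nthT : ∀ {ls ls'} → Pointwise _≈_ ls ls' → ∀ i → nthT ls i ≈ nthT ls' i
Pointwise-nthT [] i = leaf≈
Pointwise-nthT (x≈y ∷ p) zero = x≈y
Pointwise-nthT (x≈y ∷ p) (suc i) = Pointwise-nthT p i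

Pointwise-removeAt : ∀ {ls ls'} → Pointwise _≈_ ls ls' → ∀ i → Pointwise _≈_ (removeAt ls i) (removeAt ls' i)
Pointwise-removeAt [] i = []
Pointwise-removeAt (x≈y ∷ p) zero = p
Pointwise-removeAt (x≈y ∷ p) (suc i) = x≈y ∷ Pointwise-removeAt p i

Pointwise-merge : ∀ {ls ls'} → Pointwise _≈_ ls ls' → ∀ ij → Pointwise _≈_ (merge ls ij) (merge ls' ij)
Pointwise-merge p (i , j) rewrite Pointwise.Pointwise-length p =
  node≈ (Pointwise-nthT p i) (Pointwise-nthT p j) ∷ Pointwise-removeAt (Pointwise-removeAt p j) i

∑-Pointwise : ∀ {w} → ≈-Invariant w → ∀ {ls ls'} → Pointwise _≈_ ls ls' → ∑ w ls ≡ ∑ w ls'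
∑-Pointwise w-inv [] = refl
∑-Pointwise w-inv (x≈y ∷ p) = cong₂ _+_ (w-inv x≈y) (∑-Pointwise w-inv p)

∑run : (RT → ℕ) → ℕ → List RT → ℕ
∑run w f ls = ∑ w (run f ls)

∑run-suc : ∀ w f ls → ∑run w (suc f) ls ≡ ∑ (λ ij → ∑run w f (merge ls ij)) (pairs (length ls))
∑run-suc w f ls = ∑-concatMap w (λ ij → run f (merge ls ij)) (pairs (length ls))

∑run-Pointwise : ∀ {w} → ≈-Invariant w → ∀ f {ls ls'} → Pointwise _≈_ ls ls' → ∑run w f ls ≡ ∑run w f ls'
∑run-Pointwise w-inv zero p = ∑-Pointwise w-inv p
∑run-Pointwise {w} w-inv (suc f) {ls} {ls'} p = begin
    ∑run w (suc f) ls
      ≡⟨ ∑run-suc w f ls ⟩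
    ∑ (λ ij → ∑run w f (merge ls ij)) (pairs (length ls))
      ≡⟨ ∑-cong (λ ij → ∑run-Pointwise w-inv f (Pointwise-merge p ij)) (pairs (length ls)) ⟩
    ∑ (λ ij → ∑run w f (merge ls' ij)) (pairs (length ls))
      ≡⟨ cong (λ n → ∑ (λ ij → ∑run w f (merge ls' ij)) (pairs n)) (Pointwise.Pointwise-length p) ⟩
    ∑ (λ ij → ∑run w f (merge ls' ij)) (pairs (length ls'))
      ≡⟨ sym (∑run-suc w f ls') ⟩
    ∑run w (suc f) ls' ∎
  where open ≡-Reasoning

∑run-swap : ∀ {w} → ≈-Invariant w → ∀ f k x y r → ∑run w f (node k x y ∷ r) ≡ ∑run w f (node k y x ∷ r)
∑run-swap w-inv f k x y r = ∑run-Pointwise w-inv f (swap≈ (≈-refl x) (≈-refl y) ∷ Pointwise.refl (≈-refl _))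

∑-↭ : ∀ {A : Set} (w : A → ℕ) {ls ls'} → ls ↭ ls' → ∑ w ls ≡ ∑ w ls'
∑-↭ w Perm.refl = refl
∑-↭ w (Perm.prep x p) = cong (w x +_) (∑-↭ w p)
∑-↭ w (Perm.swap x y p) = trans (cong (λ s → w x + (w y + s)) (∑-↭ w p)) (+-CS.x∙yz≈y∙xz (w x) (w y) _)
∑-↭ w (Perm.trans p q) = trans (∑-↭ w p) (∑-↭ w q)

∑picks-↭ : ∀ {A : Set} {H : A → List A → ℕ} → (∀ x {r r'} → r ↭ r' → H x r ≡ H x r') →
  ∀ {ls ls'} → ls ↭ ls' → ∑picks H ls ≡ ∑picks H ls'
∑picks-↭ H-inv Perm.refl = refl
∑picks-↭ {H = H} H-inv (Perm.prep {as} {as'} a p) = begin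
    ∑picks H (a ∷ as)                          ≡⟨ ∑picks-∷ H a as ⟩
    H a as + ∑picks (λ x r → H x (a ∷ r)) as   ≡⟨ cong₂ _+_ (H-inv a p) (∑picks-↭ (λ x q → H-inv x (Perm.prep a q)) p) ⟩
    H a as' + ∑picks (λ x r → H x (a ∷ r)) as' ≡⟨ sym (∑picks-∷ H a as') ⟩
    ∑picks H (a ∷ as')                         ∎
  where open ≡-Reasoning
∑picks-↭ {H = H} H-inv (Perm.swap {xs} {ys} a b p) = begin
    ∑picks H (a ∷ b ∷ xs)
      ≡⟨ ∑picks-∷ H a (b ∷ xs) ⟩
    H a (b ∷ xs) + ∑picks (λ x r → H x (a ∷ r)) (b ∷ xs)
      ≡⟨ cong (H a (b ∷ xs) +_) (∑picks-∷ (λ x r → H x (a ∷ r)) b xs) ⟩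
    H a (b ∷ xs) + (H b (a ∷ xs) + ∑picks (λ x r → H x (a ∷ b ∷ r)) xs)
      ≡⟨ cong₂ _+_ (H-inv a (Perm.prep b p)) (cong₂ _+_ (H-inv b (Perm.prep a p)) rest) ⟩
    H a (b ∷ ys) + (H b (a ∷ ys) + ∑picks (λ x r → H x (b ∷ a ∷ r)) ys)
      ≡⟨ +-CS.x∙yz≈y∙xz (H a (b ∷ ys)) (H b (a ∷ ys)) _ ⟩
    H b (a ∷ ys) + (H a (b ∷ ys) + ∑picks (λ x r → H x (b ∷ a ∷ r)) ys)
      ≡⟨ cong (H b (a ∷ ys) +_) (sym (∑picks-∷ (λ x r → H x (b ∷ r)) a ys)) ⟩
    H b (a ∷ ys) + ∑picks (λ x r → H x (b ∷ r)) (a ∷ ys)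
      ≡⟨ sym (∑picks-∷ H b (a ∷ ys)) ⟩
    ∑picks H (b ∷ a ∷ ys) ∎
  where
  open ≡-Reasoning
  rest : ∑picks (λ x r → H x (a ∷ b ∷ r)) xs ≡ ∑picks (λ x r → H x (b ∷ a ∷ r)) ys
  rest = trans (∑picks-↭ (λ x q → H-inv x (Perm.prep a (Perm.prep b q))) p) (∑picks-cong (λ x r → H-inv x (Perm.swap a b Perm.refl)) ys)
∑picks-↭ H-inv (Perm.trans p q) = trans (∑picks-↭ H-inv p) (∑picks-↭ H-inv q)

-- Double the sum: ordered picks of the two merged lineages are manifestly invariant under permutation.
∑run-↭ : ∀ {w} → ≈-Invariant w → ∀ f {ls ls'} → ls ↭ ls' → ∑run w f ls ≡ ∑run w f ls'
∑run-↭ w-inv zero p = ∑-↭ _ p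
∑run-↭ {w} w-inv (suc f) {ls} {ls'} p = ℕ.*-cancelˡ-≡ _ _ 2 (begin
    2 * ∑run w (suc f) ls
      ≡⟨ cong (2 *_) (∑run-suc w f ls) ⟩
    2 * ∑ (λ ij → ∑run w f (merge ls ij)) (pairs (length ls))
      ≡⟨ 2*∑merge≡∑joins (∑run w f) (∑run-swap w-inv f) ls ⟩
    ∑joins (∑run w f) (length ls ∸ 1) ls
      ≡⟨ cong (λ k → ∑joins (∑run w f) k ls) (cong (_∸ 1) (↭.↭-length p)) ⟩
    ∑joins (∑run w f) (length ls' ∸ 1) ls
      ≡⟨ ∑picks-↭ (λ x q → ∑picks-↭ (λ y q' → ∑run-↭ w-inv f (Perm.prep _ q')) q) p ⟩
    ∑joins (∑run w f) (length ls' ∸ 1) ls'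
      ≡⟨ sym (2*∑merge≡∑joins (∑run w f) (∑run-swap w-inv f) ls') ⟩
    2 * ∑ (λ ij → ∑run w f (merge ls' ij)) (pairs (length ls'))
      ≡⟨ cong (2 *_) (sym (∑run-suc w f ls')) ⟩
    2 * ∑run w (suc f) ls' ∎)
  where open ≡-Reasoning

cherry : ℕ → RT
cherry K = node K leaf leaf

marks : ℕ → RT → List RT
marks K leaf = cherry K ∷ []
marks K (node k l r) = map (λ l' → node k l' r) (marks K l) ++ map (node k l) (marks K r)

marksList : ℕ → List RT → List (List RT)
marksList K [] = []
marksList K (a ∷ as) = map (_∷ as) (marks K a) ++ map (a ∷_) (marksList K as)

∑-marks-node : ∀ K (u : RT → ℕ) k l r →
  ∑ u (marks K (node k l r)) ≡ ∑ (λ x → u (node k x r)) (marks K l) + ∑ (λ y → u (node k l y)) (marks K r)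
∑-marks-node K u k l r = trans (∑-++ u (map (λ l' → node k l' r) (marks K l)) (map (node k l) (marks K r)))
  (cong₂ _+_ (∑-map u (λ l' → node k l' r) (marks K l)) (∑-map u (node k l) (marks K r)))

∑-marksList-∷ : ∀ K (u : List RT → ℕ) a as →
  ∑ u (marksList K (a ∷ as)) ≡ ∑ (λ x → u (x ∷ as)) (marks K a) + ∑ (λ r → u (a ∷ r)) (marksList K as)
∑-marksList-∷ K u a as = trans (∑-++ u (map (_∷ as) (marks K a)) (map (a ∷_) (marksList K as)))
  (cong₂ _+_ (∑-map u (_∷ as) (marks K a)) (∑-map u (a ∷_) (marksList K as)))

∑marksList-∑picks : ∀ K H ls → ∑ (∑picks H) (marksList K ls) ≡
  ∑picks (λ x r → ∑ (λ x' → H x' r) (marks K x) + ∑ (λ r' → H x r') (marksList K r)) ls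
∑marksList-∑picks K H [] = refl
∑marksList-∑picks K H (a ∷ as) = begin
    ∑ (∑picks H) (marksList K (a ∷ as))
      ≡⟨ ∑-marksList-∷ K (∑picks H) a as ⟩
    ∑ (λ a' → ∑picks H (a' ∷ as)) (marks K a) + ∑ (λ r → ∑picks H (a ∷ r)) (marksList K as)
      ≡⟨ cong₂ _+_ (∑-cong (λ a' → ∑picks-∷ H a' as) (marks K a)) (∑-cong (λ r → ∑picks-∷ H a r) (marksList K as)) ⟩
    ∑ (λ a' → H a' as + ∑picks (λ x r → H x (a' ∷ r)) as) (marks K a) + ∑ (λ r → H a r + ∑picks Ha r) (marksList K as)
      ≡⟨ cong₂ _+_ (∑-+ (λ a' → H a' as) (λ a' → ∑picks (λ x r → H x (a' ∷ r)) as) (marks K a))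
                   (∑-+ (λ r → H a r) (∑picks Ha) (marksList K as)) ⟩
    (P₁ + ∑ (λ a' → ∑picks (λ x r → H x (a' ∷ r)) as) (marks K a)) + (P₂ + ∑ (∑picks Ha) (marksList K as))
      ≡⟨ cong₂ (λ u v → (P₁ + u) + (P₂ + v)) (∑-comm (λ a' (x , r) → H x (a' ∷ r)) (marks K a) (picks as))
                                             (∑marksList-∑picks K Ha as) ⟩
    (P₁ + ∑picks Q₂ as) + (P₂ + ∑picks (λ x r → Q₁ x r + Q₃ x r) as)
      ≡⟨ cong (λ v → (P₁ + ∑picks Q₂ as) + (P₂ + v)) (∑picks-+ Q₁ Q₃ as) ⟩
    (P₁ + ∑picks Q₂ as) + (P₂ + (∑picks Q₁ as + ∑picks Q₃ as))
      ≡⟨ rearrange P₁ P₂ (∑picks Q₁ as) (∑picks Q₂ as) (∑picks Q₃ as) ⟩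
    (P₁ + P₂) + (∑picks Q₁ as + (∑picks Q₂ as + ∑picks Q₃ as))
      ≡⟨ cong ((P₁ + P₂) +_) (trans (cong (∑picks Q₁ as +_) (sym (∑picks-+ Q₂ Q₃ as))) (sym (∑picks-+ Q₁ _ as))) ⟩
    (P₁ + P₂) + ∑picks (λ x r → Q₁ x r + (Q₂ x r + Q₃ x r)) as
      ≡⟨ cong ((P₁ + P₂) +_) (∑picks-cong (λ x r → cong (Q₁ x r +_) (sym (∑-marksList-∷ K (H x) a r))) as) ⟩
    Φ a as + ∑picks (λ x r → Φ x (a ∷ r)) as
      ≡⟨ sym (∑picks-∷ Φ a as) ⟩
    ∑picks Φ (a ∷ as) ∎
  where
  open ≡-Reasoning
  Ha Φ Q₁ Q₂ Q₃ : RT → List RT → ℕ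
  Ha x r = H x (a ∷ r)
  Φ x r = ∑ (λ x' → H x' r) (marks K x) + ∑ (λ r' → H x r') (marksList K r)
  Q₁ x r = ∑ (λ x' → H x' (a ∷ r)) (marks K x)
  Q₂ x r = ∑ (λ a' → H x (a' ∷ r)) (marks K a)
  Q₃ x r = ∑ (λ r'' → H x (a ∷ r'')) (marksList K r)
  P₁ = ∑ (λ x' → H x' as) (marks K a)
  P₂ = ∑ (λ r' → H a r') (marksList K as)
  rearrange : ∀ p₁ p₂ q₁ q₂ q₃ → (p₁ + q₂) + (p₂ + (q₁ + q₃)) ≡ (p₁ + p₂) + (q₁ + (q₂ + q₃))
  rearrange = solve-∀

-- Both sides enumerate the same choices: a marked leaf and two lineages to join, in either order.
∑marksList-∑joins : ∀ K G k ls →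
  ∑ (∑joins G k) (marksList K ls) ≡ ∑joins (λ l → ∑ G (marksList K l)) k ls
∑marksList-∑joins K G k ls = begin
    ∑ (∑picks (joinWith G)) (marksList K ls)
      ≡⟨ ∑marksList-∑picks K (joinWith G) ls ⟩
    ∑picks (λ x r → ∑ (λ x' → joinWith G x' r) (marks K x) + ∑ (joinWith G x) (marksList K r)) ls
      ≡⟨ ∑picks-cong per-pick ls ⟩
    ∑joins (λ l → ∑ G (marksList K l)) k ls ∎
  where
  open ≡-Reasoning
  joinWith : (List RT → ℕ) → RT → List RT → ℕ
  joinWith G x = ∑picks (λ y r' → G (node k x y ∷ r'))
  per-pick : ∀ x r → ∑ (λ x' → joinWith G x' r) (marks K x) + ∑ (joinWith G x) (marksList K r)
                    ≡ joinWith (λ l → ∑ G (marksList K l)) x r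
  per-pick x r = begin
      ∑ (λ x' → joinWith G x' r) (marks K x) + ∑ (joinWith G x) (marksList K r)
        ≡⟨ cong₂ _+_ (∑-comm (λ x' (y , r') → G (node k x' y ∷ r')) (marks K x) (picks r))
                     (∑marksList-∑picks K (λ y r' → G (node k x y ∷ r')) r) ⟩
      ∑picks T₁ r + ∑picks (λ y r' → T₂ y r' + T₃ y r') r
        ≡⟨ sym (∑picks-+ T₁ _ r) ⟩
      ∑picks (λ y r' → T₁ y r' + (T₂ y r' + T₃ y r')) r
        ≡⟨ ∑picks-cong (λ y r' → sym (ℕ.+-assoc (T₁ y r') _ _)) r ⟩
      ∑picks (λ y r' → (T₁ y r' + T₂ y r') + T₃ y r') r
        ≡⟨ ∑picks-cong (λ y r' → cong (_+ T₃ y r') (sym (∑-marks-node K (λ t → G (t ∷ r')) k x y))) r ⟩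
      ∑picks (λ y r' → ∑ (λ t → G (t ∷ r')) (marks K (node k x y)) + T₃ y r') r
        ≡⟨ ∑picks-cong (λ y r' → sym (∑-marksList-∷ K G (node k x y) r')) r ⟩
      joinWith (λ l → ∑ G (marksList K l)) x r ∎
    where
    T₁ T₂ T₃ : RT → List RT → ℕ
    T₁ y r' = ∑ (λ x' → G (node k x' y ∷ r')) (marks K x)
    T₂ y r' = ∑ (λ y' → G (node k x y' ∷ r')) (marks K y)
    T₃ y r' = ∑ (λ r'' → G (node k x y ∷ r'')) (marksList K r')

∑-marks-≈ : ∀ K {u u' : RT → ℕ} → (∀ {x x'} → x ≈ x' → u x ≡ u' x') →
  ∀ {a a'} → a ≈ a' → ∑ u (marks K a) ≡ ∑ u' (marks K a')
∑-marks-≈ K u≈u' leaf≈ = cong (_+ 0) (u≈u' (≈-refl (cherry K)))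
∑-marks-≈ K {u} {u'} u≈u' (node≈ {k} {a} {b} {a'} {b'} a≈a' b≈b') = begin
    ∑ u (marks K (node k a b))
      ≡⟨ ∑-marks-node K u k a b ⟩
    ∑ (λ x → u (node k x b)) (marks K a) + ∑ (λ y → u (node k a y)) (marks K b)
      ≡⟨ cong₂ _+_ (∑-marks-≈ K (λ x≈ → u≈u' (node≈ x≈ b≈b')) a≈a')
                   (∑-marks-≈ K (λ y≈ → u≈u' (node≈ a≈a' y≈)) b≈b') ⟩
    ∑ (λ x → u' (node k x b')) (marks K a') + ∑ (λ y → u' (node k a' y)) (marks K b')
      ≡⟨ sym (∑-marks-node K u' k a' b') ⟩
    ∑ u' (marks K (node k a' b')) ∎
  where open ≡-Reasoning
∑-marks-≈ K {u} {u'} u≈u' (swap≈ {k} {a} {b} {a'} {b'} a≈a' b≈b') = begin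
    ∑ u (marks K (node k a b))
      ≡⟨ ∑-marks-node K u k a b ⟩
    ∑ (λ x → u (node k x b)) (marks K a) + ∑ (λ y → u (node k a y)) (marks K b)
      ≡⟨ cong₂ _+_ (∑-marks-≈ K (λ x≈ → u≈u' (swap≈ x≈ b≈b')) a≈a')
                   (∑-marks-≈ K (λ y≈ → u≈u' (swap≈ a≈a' y≈)) b≈b') ⟩
    ∑ (λ x → u' (node k b' x)) (marks K a') + ∑ (λ y → u' (node k y a')) (marks K b')
      ≡⟨ ℕ.+-comm (∑ (λ x → u' (node k b' x)) (marks K a')) _ ⟩
    ∑ (λ y → u' (node k y a')) (marks K b') + ∑ (λ x → u' (node k b' x)) (marks K a')
      ≡⟨ sym (∑-marks-node K u' k b' a') ⟩
    ∑ u' (marks K (node k b' a')) ∎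
  where open ≡-Reasoning

marksList-length : ∀ K ls → All (λ ls' → length ls' ≡ length ls) (marksList K ls)
marksList-length K [] = []
marksList-length K (a ∷ as) =
  All.++⁺ (All.map⁺ (All.tabulate (λ _ → refl))) (All.map⁺ (All.map (cong suc) (marksList-length K as)))

marksList-replicate-↭ : ∀ K n → All (_↭ cherry K ∷ replicate n leaf) (marksList K (replicate (suc n) leaf))
marksList-replicate-↭ K zero = Perm.refl ∷ []
marksList-replicate-↭ K (suc n) =
  Perm.refl ∷ All.map⁺ (All.map (λ p → Perm.trans (Perm.prep leaf p) (Perm.swap leaf (cherry K) Perm.refl)) (marksList-replicate-↭ K n))

length-marksList-replicate : ∀ K n → length (marksList K (replicate n leaf)) ≡ n
length-marksList-replicate K zero = refl
length-marksList-replicate K (suc n) =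
  cong suc (trans (List.length-map (leaf ∷_) (marksList K (replicate n leaf))) (length-marksList-replicate K n))

∑marksList-replicate : ∀ K {w} → ≈-Invariant w → ∀ f n →
  ∑ (∑run w f) (marksList K (replicate (suc n) leaf)) ≡ suc n * ∑run w f (cherry K ∷ replicate n leaf)
∑marksList-replicate K {w} w-inv f n = begin
    ∑ (∑run w f) (marksList K (replicate (suc n) leaf))
      ≡⟨ ∑-cong-All (All.map (∑run-↭ w-inv f) (marksList-replicate-↭ K n)) ⟩
    ∑ (λ _ → ∑run w f (cherry K ∷ replicate n leaf)) (marksList K (replicate (suc n) leaf))
      ≡⟨ ∑-const _ (marksList K (replicate (suc n) leaf)) ⟩
    length (marksList K (replicate (suc n) leaf)) * ∑run w f (cherry K ∷ replicate n leaf)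
      ≡⟨ cong (_* ∑run w f (cherry K ∷ replicate n leaf)) (length-marksList-replicate K (suc n)) ⟩
    suc n * ∑run w f (cherry K ∷ replicate n leaf) ∎
  where open ≡-Reasoning

Below : ℕ → RT → Set
Below K leaf = ⊤
Below K (node k l r) = k ℕ.< K × Below K l × Below K r

∑joins-cong-All : ∀ {P : RT → Set} {G G' : List RT → ℕ} k {ls} → All P ls →
  (∀ {x y r} → P x → P y → All P r → length ls ≡ suc (suc (length r)) → G (node k x y ∷ r) ≡ G' (node k x y ∷ r)) →
  ∑joins G k ls ≡ ∑joins G' k ls
∑joins-cong-All {P} {G} {G'} k {ls} all-P G≗G' = ∑-cong-All (All.map first (picks-All all-P))
  where
  first : ∀ {(x , r) : RT × List RT} → P x × All P r × length ls ≡ suc (length r) →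
    ∑picks (λ y r' → G (node k x y ∷ r')) r ≡ ∑picks (λ y r' → G' (node k x y ∷ r')) r
  first (px , pr , len) = ∑-cong-All (All.map (λ (py , pr' , len') → G≗G' px py pr' (trans len (cong suc len'))) (picks-All pr))

markSum : ℕ → (RT → ℕ) → RT → ℕ
markSum K w T = ∑ w (marks K T)

markSum-≈-Invariant : ∀ K {w} → ≈-Invariant w → ≈-Invariant (markSum K w)
markSum-≈-Invariant K w-inv = ∑-marks-≈ K w-inv

module _ (K : ℕ) (w : RT → ℕ) (w-inv : ≈-Invariant w) (w-unmarked : ∀ T → Below K T → w T ≡ 0) where

  private
    ∑-unmarked : ∀ {ls} → All (Below K) ls → ∑ w ls ≡ 0
    ∑-unmarked [] = refl
    ∑-unmarked {x ∷ _} (bx ∷ bs) rewrite w-unmarked x bx = ∑-unmarked bs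

    ∑marksList-∑ : ∀ {ls} → All (Below K) ls → ∑ (∑ w) (marksList K ls) ≡ ∑ (markSum K w) ls
    ∑marksList-∑ {[]} [] = refl
    ∑marksList-∑ {a ∷ as} (ba ∷ bs) = begin
        ∑ (∑ w) (marksList K (a ∷ as))
          ≡⟨ ∑-marksList-∷ K (∑ w) a as ⟩
        ∑ (λ x → w x + ∑ w as) (marks K a) + ∑ (λ r → w a + ∑ w r) (marksList K as)
          ≡⟨ cong₂ _+_ (∑-cong (λ x → trans (cong (w x +_) (∑-unmarked bs)) (ℕ.+-identityʳ (w x))) (marks K a))
                       (∑-cong (λ r → cong (_+ ∑ w r) (w-unmarked a ba)) (marksList K as)) ⟩
        markSum K w a + ∑ (∑ w) (marksList K as)
          ≡⟨ cong (markSum K w a +_) (∑marksList-∑ bs) ⟩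
        markSum K w a + ∑ (markSum K w) as ∎
      where open ≡-Reasoning

  ∑marksList-run : ∀ f {ls} → All (Below K) ls → length ls ≤ K →
    ∑ (∑run w f) (marksList K ls) ≡ ∑run (markSum K w) f ls
  ∑marksList-run zero below _ = ∑marksList-∑ below
  ∑marksList-run (suc f) {ls} below len≤K = ℕ.*-cancelˡ-≡ _ _ 2 (begin
      2 * ∑ (∑run w (suc f)) (marksList K ls)
        ≡⟨ sym (∑-*ˡ 2 (∑run w (suc f)) (marksList K ls)) ⟩
      ∑ (λ ls' → 2 * ∑run w (suc f) ls') (marksList K ls)
        ≡⟨ ∑-cong-All (All.map (λ {ls'} → doubled {ls'}) (marksList-length K ls)) ⟩
      ∑ (∑joins (∑run w f) k) (marksList K ls)
        ≡⟨ ∑marksList-∑joins K (∑run w f) k ls ⟩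
      ∑joins (λ l → ∑ (∑run w f) (marksList K l)) k ls
        ≡⟨ ∑joins-cong-All {G = λ l → ∑ (∑run w f) (marksList K l)} {G' = ∑run (markSum K w) f} k below induction ⟩
      ∑joins (∑run (markSum K w) f) k ls
        ≡⟨ sym (2*∑merge≡∑joins (∑run (markSum K w) f) (∑run-swap (markSum-≈-Invariant K w-inv) f) ls) ⟩
      2 * ∑ (λ ij → ∑run (markSum K w) f (merge ls ij)) (pairs (length ls))
        ≡⟨ cong (2 *_) (sym (∑run-suc (markSum K w) f ls)) ⟩
      2 * ∑run (markSum K w) (suc f) ls ∎)
    where
    open ≡-Reasoning
    k = length ls ∸ 1
    doubled : ∀ {ls'} → length ls' ≡ length ls → 2 * ∑run w (suc f) ls' ≡ ∑joins (∑run w f) k ls'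
    doubled {ls'} len = trans (cong (2 *_) (∑run-suc w f ls'))
      (trans (2*∑merge≡∑joins (∑run w f) (∑run-swap w-inv f) ls') (cong (λ n → ∑joins (∑run w f) (n ∸ 1) ls') len))
    induction : ∀ {x y r} → Below K x → Below K y → All (Below K) r → length ls ≡ suc (suc (length r)) →
      ∑ (∑run w f) (marksList K (node k x y ∷ r)) ≡ ∑run (markSum K w) f (node k x y ∷ r)
    induction {r = r} bx by br len = ∑marksList-run f ((k<K , bx , by) ∷ br) 1+r≤K
      where
      k≡1+r : k ≡ suc (length r)
      k≡1+r = cong (_∸ 1) len
      1+r≤K : suc (length r) ≤ K
      1+r≤K = ℕ.≤-trans (ℕ.n≤1+n (suc (length r))) (ℕ.≤-trans (ℕ.≤-reflexive (sym len)) len≤K)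
      k<K : k ℕ.< K
      k<K = ℕ.≤-trans (ℕ.≤-reflexive (cong suc k≡1+r)) (ℕ.≤-trans (ℕ.≤-reflexive (sym len)) len≤K)

rank : RT → ℕ
rank leaf = 0
rank (node k _ _) = k

edgeTo : ℕ → RT → List (ℕ × ℕ)
edgeTo k leaf = []
edgeTo k (node c _ _) = (c , k) ∷ []

edges-node : ∀ k l r → edges (node k l r) ≡ edgeTo k l ++ edgeTo k r ++ edges l ++ edges r
edges-node k leaf leaf = refl
edges-node k leaf (node _ _ _) = refl
edges-node k (node _ _ _) leaf = refl
edges-node k (node _ _ _) (node _ _ _) = refl

-- Unlike `lookupParent`, which takes the first matching edge, this does not depend on the order of the edges.
maxParent : List (ℕ × ℕ) → ℕ → ℕ
maxParent [] i = 0
maxParent ((c , p) ∷ es) i = if c ≡ᵇ i then p ⊔ maxParent es i else maxParent es i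

maxParent-++ : ∀ xs ys i → maxParent (xs ++ ys) i ≡ maxParent xs i ⊔ maxParent ys i
maxParent-++ [] ys i = refl
maxParent-++ ((c , p) ∷ xs) ys i with c ≡ᵇ i
... | true = trans (cong (p ⊔_) (maxParent-++ xs ys i)) (sym (ℕ.⊔-assoc p (maxParent xs i) (maxParent ys i)))
... | false = maxParent-++ xs ys i

maxParent-node : ∀ k l r i → maxParent (edges (node k l r)) i ≡
  maxParent (edgeTo k l) i ⊔ (maxParent (edgeTo k r) i ⊔ (maxParent (edges l) i ⊔ maxParent (edges r) i))
maxParent-node k l r i
  rewrite edges-node k l r | maxParent-++ (edgeTo k l) (edgeTo k r ++ edges l ++ edges r) i
        | maxParent-++ (edgeTo k r) (edges l ++ edges r) i | maxParent-++ (edges l) (edges r) i = refl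

parentOf : ℕ → RT → ℕ
parentOf K T = maxParent (edges T) K

ρmax : ℕ → RT → List ℕ
ρmax m T = map (maxParent (edges T)) (range 2 (suc m))

edgeTo-≈ : ∀ k {x y} → x ≈ y → edgeTo k x ≡ edgeTo k y
edgeTo-≈ k leaf≈ = refl
edgeTo-≈ k (node≈ _ _) = refl
edgeTo-≈ k (swap≈ _ _) = refl

parentOf-≈ : ∀ i {x y} → x ≈ y → parentOf i x ≡ parentOf i y
parentOf-≈ i leaf≈ = refl
parentOf-≈ i (node≈ {k} {a} {b} {a'} {b'} a≈ b≈)
  rewrite maxParent-node k a b i | maxParent-node k a' b' i | edgeTo-≈ k a≈ | edgeTo-≈ k b≈
        | parentOf-≈ i a≈ | parentOf-≈ i b≈ = refl
parentOf-≈ i (swap≈ {k} {a} {b} {a'} {b'} a≈ b≈)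
  rewrite maxParent-node k a b i | maxParent-node k b' a' i | edgeTo-≈ k a≈ | edgeTo-≈ k b≈
        | parentOf-≈ i a≈ | parentOf-≈ i b≈ = swap-⊔ (maxParent (edgeTo k a') i) (maxParent (edgeTo k b') i) (parentOf i a') (parentOf i b')
  where
  swap-⊔ : ∀ a b c d → a ⊔ (b ⊔ (c ⊔ d)) ≡ b ⊔ (a ⊔ (d ⊔ c))
  swap-⊔ a b c d = trans (sym (ℕ.⊔-assoc a b (c ⊔ d)))
    (trans (cong₂ _⊔_ (ℕ.⊔-comm a b) (ℕ.⊔-comm c d)) (ℕ.⊔-assoc b a (d ⊔ c)))

ρmax-≈ : ∀ m {x y} → x ≈ y → ρmax m x ≡ ρmax m y
ρmax-≈ m x≈y = List.map-cong (λ i → parentOf-≈ i x≈y) (range 2 (suc m))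

erase : ℕ → RT → RT
erase K leaf = leaf
erase K (node k l r) = if k ≡ᵇ K then leaf else node k (erase K l) (erase K r)

data OneCherry (K : ℕ) : RT → Set where
  here : OneCherry K (cherry K)
  inLeft : ∀ {k l r} → k ℕ.< K → OneCherry K l → Below K r → OneCherry K (node k l r)
  inRight : ∀ {k l r} → k ℕ.< K → Below K l → OneCherry K r → OneCherry K (node k l r)

OneCherry-child : ∀ {K l} → OneCherry K l → l ≡ cherry K ⊎ Σ ℕ λ k → Σ RT λ a → Σ RT λ b → l ≡ node k a b × k ℕ.< K
OneCherry-child here = inj₁ refl
OneCherry-child (inLeft {k} {l} {r} k<K _ _) = inj₂ (k , l , r , refl , k<K)
OneCherry-child (inRight {k} {l} {r} k<K _ _) = inj₂ (k , l , r , refl , k<K)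

erase-cherry : ∀ K → erase K (cherry K) ≡ leaf
erase-cherry K rewrite ≡ᵇ-refl K = refl

erase-Below : ∀ K T → Below K T → erase K T ≡ T
erase-Below K leaf _ = refl
erase-Below K (node k l r) (k<K , bl , br) rewrite <⇒≡ᵇ≡false k<K | erase-Below K l bl | erase-Below K r br = refl

erase-node : ∀ K k l r → k ℕ.< K → erase K (node k l r) ≡ node k (erase K l) (erase K r)
erase-node K k l r k<K rewrite <⇒≡ᵇ≡false k<K = refl

erase-nodeˡ : ∀ K k l r → k ℕ.< K → Below K r → erase K (node k l r) ≡ node k (erase K l) r
erase-nodeˡ K k l r k<K br = trans (erase-node K k l r k<K) (cong (node k (erase K l)) (erase-Below K r br))

erase-nodeʳ : ∀ K k l r → k ℕ.< K → Below K l → erase K (node k l r) ≡ node k l (erase K r)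
erase-nodeʳ K k l r k<K bl = trans (erase-node K k l r k<K) (cong (λ l' → node k l' (erase K r)) (erase-Below K l bl))

maxParent-edgeTo-Below : ∀ K k x → Below K x → maxParent (edgeTo k x) K ≡ 0
maxParent-edgeTo-Below K k leaf _ = refl
maxParent-edgeTo-Below K k (node c _ _) (c<K , _) rewrite <⇒≡ᵇ≡false c<K = refl

parentOf-Below : ∀ K T → Below K T → parentOf K T ≡ 0
parentOf-Below K leaf _ = refl
parentOf-Below K (node k l r) (k<K , bl , br)
  rewrite maxParent-node k l r K | maxParent-edgeTo-Below K k l bl | maxParent-edgeTo-Below K k r br
        | parentOf-Below K l bl | parentOf-Below K r br = refl

parentOf-cherryˡ : ∀ K k r → Below K r → parentOf K (node k (cherry K) r) ≡ k
parentOf-cherryˡ K k r br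
  rewrite maxParent-node k (cherry K) r K | ≡ᵇ-refl K | maxParent-edgeTo-Below K k r br | parentOf-Below K r br
  = trans (ℕ.⊔-identityʳ (k ⊔ 0)) (ℕ.⊔-identityʳ k)

parentOf-cherryʳ : ∀ K k l → Below K l → parentOf K (node k l (cherry K)) ≡ k
parentOf-cherryʳ K k l bl
  rewrite maxParent-node k l (cherry K) K | ≡ᵇ-refl K | maxParent-edgeTo-Below K k l bl | parentOf-Below K l bl
  = trans (ℕ.⊔-identityʳ (k ⊔ 0)) (ℕ.⊔-identityʳ k)

parentOf-nodeˡ : ∀ K k k' a b r → k' ℕ.< K → Below K r → parentOf K (node k (node k' a b) r) ≡ parentOf K (node k' a b)
parentOf-nodeˡ K k k' a b r k'<K br
  rewrite maxParent-node k (node k' a b) r K | <⇒≡ᵇ≡false k'<K | maxParent-edgeTo-Below K k r br | parentOf-Below K r br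
  = ℕ.⊔-identityʳ _

parentOf-nodeʳ : ∀ K k k' a b l → k' ℕ.< K → Below K l → parentOf K (node k l (node k' a b)) ≡ parentOf K (node k' a b)
parentOf-nodeʳ K k k' a b l k'<K bl
  rewrite maxParent-node k l (node k' a b) K | <⇒≡ᵇ≡false k'<K | maxParent-edgeTo-Below K k l bl | parentOf-Below K l bl
  = refl

maxParent-edgeTo-erase : ∀ {K l} k i → OneCherry K l → i ≢ K → maxParent (edgeTo k l) i ≡ maxParent (edgeTo k (erase K l)) i
maxParent-edgeTo-erase {K} k i ol i≢K with OneCherry-child ol
... | inj₁ refl rewrite erase-cherry K | ≢⇒≡ᵇ≡false (i≢K ∘ sym) = refl
... | inj₂ (k' , a , b , refl , k'<K) rewrite erase-node K k' a b k'<K = refl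

parentOf-erase : ∀ {K T} → OneCherry K T → ∀ i → i ≢ K → parentOf i T ≡ parentOf i (erase K T)
parentOf-erase {K} here i i≢K rewrite erase-cherry K = refl
parentOf-erase {K} (inLeft {k} {l} {r} k<K ol br) i i≢K
  rewrite erase-node K k l r k<K | erase-Below K r br | maxParent-node k l r i | maxParent-node k (erase K l) r i
        | maxParent-edgeTo-erase k i ol i≢K | parentOf-erase ol i i≢K = refl
parentOf-erase {K} (inRight {k} {l} {r} k<K bl or) i i≢K
  rewrite erase-node K k l r k<K | erase-Below K l bl | maxParent-node k l r i | maxParent-node k l (erase K r) i
        | maxParent-edgeTo-erase k i or i≢K | parentOf-erase or i i≢K = refl

-- Quantifying over the edges that follow makes this relation a congruence for _++_.
record SameParent (i : ℕ) (xs ys : List (ℕ × ℕ)) : Set where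
  constructor sameParent
  field lookupParent-++ : ∀ zs → lookupParent (xs ++ zs) i ≡ lookupParent (ys ++ zs) i
open SameParent

SameParent-refl : ∀ {i} xs → SameParent i xs xs
SameParent-refl xs = sameParent λ zs → refl

SameParent-++ : ∀ {i xs ys xs' ys'} → SameParent i xs ys → SameParent i xs' ys' → SameParent i (xs ++ xs') (ys ++ ys')
SameParent-++ {i} {xs} {ys} {xs'} {ys'} xs~ys xs'~ys' = sameParent λ zs → begin
    lookupParent ((xs ++ xs') ++ zs) i ≡⟨ cong (λ es → lookupParent es i) (List.++-assoc xs xs' zs) ⟩
    lookupParent (xs ++ (xs' ++ zs)) i ≡⟨ lookupParent-++ xs~ys (xs' ++ zs) ⟩
    lookupParent (ys ++ (xs' ++ zs)) i ≡⟨ prefix ys (lookupParent-++ xs'~ys' zs) ⟩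
    lookupParent (ys ++ (ys' ++ zs)) i ≡⟨ cong (λ es → lookupParent es i) (sym (List.++-assoc ys ys' zs)) ⟩
    lookupParent ((ys ++ ys') ++ zs) i ∎
  where
  open ≡-Reasoning
  prefix : ∀ ys {A B} → lookupParent A i ≡ lookupParent B i → lookupParent (ys ++ A) i ≡ lookupParent (ys ++ B) i
  prefix [] eq = eq
  prefix ((c , p) ∷ ys) eq with c ≡ᵇ i
  ... | true = refl
  ... | false = prefix ys eq

SameParent-skip : ∀ {c i} p xs → c ≢ i → SameParent i ((c , p) ∷ xs) xs
SameParent-skip {c} {i} p xs c≢i = sameParent skip
  where
  skip : ∀ zs → lookupParent (((c , p) ∷ xs) ++ zs) i ≡ lookupParent (xs ++ zs) i
  skip zs rewrite ≢⇒≡ᵇ≡false c≢i = refl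

SameParent-found : ∀ {i} p xs → SameParent i ((i , p) ∷ xs) ((i , p) ∷ [])
SameParent-found {i} p xs = sameParent found
  where
  found : ∀ zs → lookupParent (((i , p) ∷ xs) ++ zs) i ≡ lookupParent (((i , p) ∷ []) ++ zs) i
  found zs rewrite ≡ᵇ-refl i = refl

SameParent-edgeTo-Below : ∀ {K} k x → Below K x → SameParent K (edgeTo k x) []
SameParent-edgeTo-Below k leaf _ = SameParent-refl []
SameParent-edgeTo-Below k (node c _ _) (c<K , _) = SameParent-skip k [] (ℕ.<⇒≢ c<K)

SameParent-node : ∀ {i ys₁ ys₂ ys₃ ys₄} k l r →
  SameParent i (edgeTo k l) ys₁ → SameParent i (edgeTo k r) ys₂ → SameParent i (edges l) ys₃ → SameParent i (edges r) ys₄ →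
  SameParent i (edges (node k l r)) (ys₁ ++ ys₂ ++ ys₃ ++ ys₄)
SameParent-node k l r s₁ s₂ s₃ s₄ rewrite edges-node k l r =
  SameParent-++ s₁ (SameParent-++ s₂ (SameParent-++ s₃ s₄))

SameParent-Below : ∀ {K} T → Below K T → SameParent K (edges T) []
SameParent-Below leaf _ = SameParent-refl []
SameParent-Below (node k l r) (_ , bl , br) =
  SameParent-node k l r (SameParent-edgeTo-Below k l bl) (SameParent-edgeTo-Below k r br) (SameParent-Below l bl) (SameParent-Below r br)

SameParent-OneCherry : ∀ {K T} → OneCherry K T → rank T ≢ K → SameParent K (edges T) ((K , parentOf K T) ∷ [])
SameParent-OneCherry here K≢K = ⊥-elim (K≢K refl)
SameParent-OneCherry {K} (inLeft {k} {l} {r} k<K ol br) _ with OneCherry-child ol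
... | inj₁ refl rewrite parentOf-cherryˡ K k r br = SameParent-found k _
... | inj₂ (k' , a , b , refl , k'<K) rewrite parentOf-nodeˡ K k k' a b r k'<K br =
  SameParent-node k (node k' a b) r (SameParent-skip k [] (ℕ.<⇒≢ k'<K)) (SameParent-edgeTo-Below k r br)
                  (SameParent-OneCherry ol (ℕ.<⇒≢ k'<K)) (SameParent-Below r br)
SameParent-OneCherry {K} (inRight {k} {l} {r} k<K bl or) _ with OneCherry-child or
... | inj₁ refl rewrite parentOf-cherryʳ K k l bl =
  SameParent-node k l (cherry K) (SameParent-edgeTo-Below k l bl) (SameParent-found k []) (SameParent-Below l bl) (SameParent-refl [])
... | inj₂ (k' , a , b , refl , k'<K) rewrite parentOf-nodeʳ K k k' a b l k'<K bl =
  SameParent-node k l (node k' a b) (SameParent-edgeTo-Below k l bl) (SameParent-skip k [] (ℕ.<⇒≢ k'<K))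
                  (SameParent-Below l bl) (SameParent-OneCherry or (ℕ.<⇒≢ k'<K))

SameParent-edgeTo-erase : ∀ {K l i} k → OneCherry K l → i ≢ K → SameParent i (edgeTo k l) (edgeTo k (erase K l))
SameParent-edgeTo-erase {K} k ol i≢K with OneCherry-child ol
... | inj₁ refl rewrite erase-cherry K = SameParent-skip k [] (i≢K ∘ sym)
... | inj₂ (k' , a , b , refl , k'<K) rewrite erase-node K k' a b k'<K = SameParent-refl _

SameParent-erase : ∀ {K T i} → OneCherry K T → i ≢ K → SameParent i (edges T) (edges (erase K T))
SameParent-erase {K} here _ rewrite erase-cherry K = SameParent-refl []
SameParent-erase {K} (inLeft {k} {l} {r} k<K ol br) i≢K
  rewrite erase-nodeˡ K k l r k<K br | edges-node k (erase K l) r =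
  SameParent-node k l r (SameParent-edgeTo-erase k ol i≢K) (SameParent-refl _) (SameParent-erase ol i≢K) (SameParent-refl _)
SameParent-erase {K} (inRight {k} {l} {r} k<K bl or) i≢K
  rewrite erase-nodeʳ K k l r k<K bl | edges-node k l (erase K r) =
  SameParent-node k l r (SameParent-refl _) (SameParent-edgeTo-erase k or i≢K) (SameParent-refl _) (SameParent-erase or i≢K)

SameParent⇒lookupParent : ∀ {i xs ys} → SameParent i xs ys → lookupParent xs i ≡ lookupParent ys i
SameParent⇒lookupParent {i} {xs} {ys} xs~ys = begin
    lookupParent xs i        ≡⟨ cong (λ es → lookupParent es i) (sym (List.++-identityʳ xs)) ⟩
    lookupParent (xs ++ []) i ≡⟨ lookupParent-++ xs~ys [] ⟩
    lookupParent (ys ++ []) i ≡⟨ cong (λ es → lookupParent es i) (List.++-identityʳ ys) ⟩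
    lookupParent ys i        ∎
  where open ≡-Reasoning

lookupParent-OneCherry : ∀ {K T} → OneCherry K T → rank T ≢ K → lookupParent (edges T) K ≡ parentOf K T
lookupParent-OneCherry {K} {T} oT rank≢K = trans (SameParent⇒lookupParent (SameParent-OneCherry oT rank≢K))
  (cong (λ b → if b then parentOf K T else 0) (≡ᵇ-refl K))

lookupParent-erase : ∀ {K T} → OneCherry K T → ∀ i → i ≢ K → lookupParent (edges T) i ≡ lookupParent (edges (erase K T)) i
lookupParent-erase oT i i≢K = SameParent⇒lookupParent (SameParent-erase oT i≢K)

isLeaf : RT → ℕ
isLeaf leaf = 1
isLeaf (node _ _ _) = 0

leafChildren : ℕ → RT → ℕ
leafChildren p leaf = 0
leafChildren p (node k l r) = χ (k ≡ᵇ p) * (isLeaf l + isLeaf r) + leafChildren p l + leafChildren p r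

leafChildren-Below : ∀ K T → Below K T → leafChildren K T ≡ 0
leafChildren-Below K leaf _ = refl
leafChildren-Below K (node k l r) (k<K , bl , br)
  rewrite <⇒≡ᵇ≡false k<K | leafChildren-Below K l bl | leafChildren-Below K r br = refl

leafChildren-OneCherry : ∀ {K T} → OneCherry K T → leafChildren K T ≡ 2
leafChildren-OneCherry {K} here rewrite ≡ᵇ-refl K = refl
leafChildren-OneCherry {K} (inLeft {k} {l} {r} k<K ol br)
  rewrite <⇒≡ᵇ≡false k<K | leafChildren-OneCherry ol | leafChildren-Below K r br = refl
leafChildren-OneCherry {K} (inRight {k} {l} {r} k<K bl or)
  rewrite <⇒≡ᵇ≡false k<K | leafChildren-OneCherry or | leafChildren-Below K l bl = ℕ.+-identityʳ 2

leafChildren-cherry : ∀ K p → p ≢ K → leafChildren p (cherry K) ≡ 0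
leafChildren-cherry K p p≢K rewrite ≢⇒≡ᵇ≡false (p≢K ∘ sym) = refl

isLeaf-erase-node : ∀ {K k a b} → k ℕ.< K → isLeaf (erase K (node k a b)) ≡ 0
isLeaf-erase-node {K} {k} {a} {b} k<K rewrite erase-node K k a b k<K = refl

-- Erasing the cherry turns it into a leaf child of its parent (p ≢ 0 because a root cherry has parent 0).
leafChildren-erase : ∀ {K T} → OneCherry K T → ∀ p → p ≢ 0 → p ≢ K →
  leafChildren p (erase K T) ≡ leafChildren p T + χ (parentOf K T ≡ᵇ p)
leafChildren-erase {K} here p p≢0 p≢K
  rewrite erase-cherry K | leafChildren-cherry K p p≢K | ≢⇒≡ᵇ≡false {0} {p} (p≢0 ∘ sym) = refl
leafChildren-erase {K} (inLeft {k} {l} {r} k<K ol br) p p≢0 p≢K with OneCherry-child ol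
... | inj₁ refl
  rewrite erase-nodeˡ K k (cherry K) r k<K br | erase-cherry K | leafChildren-cherry K p p≢K | parentOf-cherryˡ K k r br
  = arithmetic (χ (k ≡ᵇ p)) (isLeaf r) (leafChildren p r)
  where
  arithmetic : ∀ c a b → c * (1 + a) + 0 + b ≡ c * (0 + a) + 0 + b + c
  arithmetic = solve-∀
... | inj₂ (k' , a , b , refl , k'<K)
  rewrite erase-nodeˡ K k (node k' a b) r k<K br | parentOf-nodeˡ K k k' a b r k'<K br
  = trans (cong₂ (λ i n → χ (k ≡ᵇ p) * (i + isLeaf r) + n + leafChildren p r)
                 (isLeaf-erase-node {a = a} {b} k'<K) (leafChildren-erase ol p p≢0 p≢K))
      (arithmetic (χ (k ≡ᵇ p) * (0 + isLeaf r)) (leafChildren p (node k' a b)) _ (leafChildren p r))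
  where
  arithmetic : ∀ x y z w → x + (y + z) + w ≡ x + y + w + z
  arithmetic = solve-∀
leafChildren-erase {K} (inRight {k} {l} {r} k<K bl or) p p≢0 p≢K with OneCherry-child or
... | inj₁ refl
  rewrite erase-nodeʳ K k l (cherry K) k<K bl | erase-cherry K | leafChildren-cherry K p p≢K | parentOf-cherryʳ K k l bl
  = arithmetic (χ (k ≡ᵇ p)) (isLeaf l) (leafChildren p l)
  where
  arithmetic : ∀ c a b → c * (a + 1) + b + 0 ≡ c * (a + 0) + b + 0 + c
  arithmetic = solve-∀
... | inj₂ (k' , a , b , refl , k'<K)
  rewrite erase-nodeʳ K k l (node k' a b) k<K bl | parentOf-nodeʳ K k k' a b l k'<K bl
  = trans (cong₂ (λ i n → χ (k ≡ᵇ p) * (isLeaf l + i) + leafChildren p l + n)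
                 (isLeaf-erase-node {a = a} {b} k'<K) (leafChildren-erase or p p≢0 p≢K))
      (sym (ℕ.+-assoc (χ (k ≡ᵇ p) * (isLeaf l + 0) + leafChildren p l) (leafChildren p (node k' a b)) _))

RanksIn : ℕ → ℕ → RT → Set
RanksIn lo hi leaf = ⊤
RanksIn lo hi (node k l r) = lo ≤ k × k ≤ hi × RanksIn lo hi l × RanksIn lo hi r

RanksIn⇒Below : ∀ {lo hi K} T → hi ℕ.< K → RanksIn lo hi T → Below K T
RanksIn⇒Below leaf _ _ = _
RanksIn⇒Below (node k l r) hi<K (_ , k≤hi , inl , inr) =
  ℕ.≤-<-trans k≤hi hi<K , RanksIn⇒Below l hi<K inl , RanksIn⇒Below r hi<K inr

parentOf-bounds : ∀ {K T hi} → OneCherry K T → rank T ≢ K → RanksIn 1 hi (erase K T) → 1 ≤ parentOf K T × parentOf K T ≤ hi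
parentOf-bounds here K≢K _ = ⊥-elim (K≢K refl)
parentOf-bounds {K} {hi = hi} (inLeft {k} {l} {r} k<K ol br) _ inT with OneCherry-child ol
... | inj₁ refl rewrite parentOf-cherryˡ K k r br | erase-nodeˡ K k (cherry K) r k<K br = proj₁ inT , proj₁ (proj₂ inT)
... | inj₂ (k' , a , b , refl , k'<K) rewrite parentOf-nodeˡ K k k' a b r k'<K br | erase-nodeˡ K k (node k' a b) r k<K br =
  parentOf-bounds ol (ℕ.<⇒≢ k'<K) (proj₁ (proj₂ (proj₂ inT)))
parentOf-bounds {K} {hi = hi} (inRight {k} {l} {r} k<K bl or) _ inT with OneCherry-child or
... | inj₁ refl rewrite parentOf-cherryʳ K k l bl | erase-nodeʳ K k l (cherry K) k<K bl = proj₁ inT , proj₁ (proj₂ inT)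
... | inj₂ (k' , a , b , refl , k'<K) rewrite parentOf-nodeʳ K k k' a b l k'<K bl | erase-nodeʳ K k l (node k' a b) k<K bl =
  parentOf-bounds or (ℕ.<⇒≢ k'<K) (proj₂ (proj₂ (proj₂ inT)))

parentOf-≤ : ∀ {lo hi} T → RanksIn lo hi T → ∀ i → parentOf i T ≤ hi
parentOf-≤ {lo} {hi} T inT i = maxParent-≤ (edges T) (edges-≤ T inT)
  where
  maxParent-≤ : ∀ es → All (λ (_ , p) → p ≤ hi) es → maxParent es i ≤ hi
  maxParent-≤ [] _ = z≤n
  maxParent-≤ ((c , p) ∷ es) (p≤hi ∷ ps) with c ≡ᵇ i
  ... | true = ℕ.⊔-lub p≤hi (maxParent-≤ es ps)
  ... | false = maxParent-≤ es ps
  edgeTo-≤ : ∀ k x → k ≤ hi → All (λ (_ , p) → p ≤ hi) (edgeTo k x)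
  edgeTo-≤ k leaf _ = []
  edgeTo-≤ k (node _ _ _) k≤hi = k≤hi ∷ []
  edges-≤ : ∀ T → RanksIn lo hi T → All (λ (_ , p) → p ≤ hi) (edges T)
  edges-≤ leaf _ = []
  edges-≤ (node k l r) (_ , k≤hi , inl , inr) = ≡-subst (All _) (sym (edges-node k l r))
    (All.++⁺ (edgeTo-≤ k l k≤hi) (All.++⁺ (edgeTo-≤ k r k≤hi) (All.++⁺ (edges-≤ l inl) (edges-≤ r inr))))

occurrences-∷ : ∀ k x xs → occurrences k (x ∷ xs) ≡ χ (k ≡ᵇ x) + occurrences k xs
occurrences-∷ k x xs with k ≡ᵇ x
... | true = refl
... | false = refl

occurrences-∷ʳ : ∀ k xs x → occurrences k (xs ++ x ∷ []) ≡ occurrences k xs + χ (k ≡ᵇ x)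
occurrences-∷ʳ k [] x = trans (occurrences-∷ k x []) (ℕ.+-identityʳ _)
occurrences-∷ʳ k (y ∷ xs) x = begin
    occurrences k (y ∷ xs ++ x ∷ [])                   ≡⟨ occurrences-∷ k y (xs ++ x ∷ []) ⟩
    χ (k ≡ᵇ y) + occurrences k (xs ++ x ∷ [])           ≡⟨ cong (χ (k ≡ᵇ y) +_) (occurrences-∷ʳ k xs x) ⟩
    χ (k ≡ᵇ y) + (occurrences k xs + χ (k ≡ᵇ x))        ≡⟨ sym (ℕ.+-assoc (χ (k ≡ᵇ y)) _ _) ⟩
    χ (k ≡ᵇ y) + occurrences k xs + χ (k ≡ᵇ x)          ≡⟨ cong (_+ χ (k ≡ᵇ x)) (sym (occurrences-∷ k y xs)) ⟩
    occurrences k (y ∷ xs) + χ (k ≡ᵇ x)                 ∎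
  where open ≡-Reasoning

occurrences-absent : ∀ K xs → All (ℕ._< K) xs → occurrences K xs ≡ 0
occurrences-absent K [] [] = refl
occurrences-absent K (x ∷ xs) (x<K ∷ xs<K) =
  trans (occurrences-∷ K x xs) (cong₂ _+_ (cong χ (≢⇒≡ᵇ≡false (ℕ.>⇒≢ x<K))) (occurrences-absent K xs xs<K))

occurrences-oneTo : ∀ m k → 1 ≤ k → k ≤ m → occurrences k (oneTo m) ≡ 1
occurrences-oneTo zero k 1≤k k≤0 = ⊥-elim (ℕ.<⇒≱ (ℕ.≤-<-trans k≤0 (s≤s z≤n)) 1≤k)
occurrences-oneTo (suc m) k 1≤k k≤1+m with ℕ.m≤n⇒m<n∨m≡n k≤1+m
... | inj₁ (s≤s k≤m) = trans (occurrences-∷ʳ k (oneTo m) (suc m))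
  (cong₂ _+_ (occurrences-oneTo m k 1≤k k≤m) (cong χ (≢⇒≡ᵇ≡false (ℕ.<⇒≢ (s≤s k≤m)))))
... | inj₂ refl = trans (occurrences-∷ʳ (suc m) (oneTo m) (suc m))
  (cong₂ _+_ (occurrences-absent (suc m) (oneTo m) (All.map (s≤s ∘ proj₂) (oneTo-bounds m))) (cong χ (≡ᵇ-refl m)))

∑-χ≡ᵇ : ∀ k (F : ℕ → ℕ) xs → ∑ (λ p → χ (k ≡ᵇ p) * F p) xs ≡ occurrences k xs * F k
∑-χ≡ᵇ k F [] = refl
∑-χ≡ᵇ k F (x ∷ xs) = trans head (cong (_* F k) (sym (occurrences-∷ k x xs)))
  where
  head : ∑ (λ p → χ (k ≡ᵇ p) * F p) (x ∷ xs) ≡ (χ (k ≡ᵇ x) + occurrences k xs) * F k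
  head with k ≡ᵇ x | ≡ᵇ-view k x
  ... | .true | equal refl = cong₂ _+_ (ℕ.+-identityʳ (F k)) (∑-χ≡ᵇ k F xs)
  ... | .false | different _ = ∑-χ≡ᵇ k F xs

leafParentSum : (ℕ → ℕ) → RT → ℕ
leafParentSum h leaf = 0
leafParentSum h (node k l r) = (isLeaf l + isLeaf r) * h k + leafParentSum h l + leafParentSum h r

leafParentSum≡∑leafChildren : ∀ m h T → RanksIn 1 m T → leafParentSum h T ≡ ∑ (λ p → h p * leafChildren p T) (oneTo m)
leafParentSum≡∑leafChildren m h leaf _ = sym (trans (∑-cong (λ p → ℕ.*-zeroʳ (h p)) (oneTo m)) (∑-zero (oneTo m)))
leafParentSum≡∑leafChildren m h (node k l r) (1≤k , k≤m , inl , inr) = sym (begin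
    ∑ (λ p → h p * leafChildren p (node k l r)) (oneTo m)
      ≡⟨ ∑-cong (λ p → distribute (h p) (χ (k ≡ᵇ p)) (isLeaf l + isLeaf r) (leafChildren p l) (leafChildren p r)) (oneTo m) ⟩
    ∑ (λ p → χ (k ≡ᵇ p) * (s * h p) + (h p * leafChildren p l + h p * leafChildren p r)) (oneTo m)
      ≡⟨ ∑-+ _ _ (oneTo m) ⟩
    ∑ (λ p → χ (k ≡ᵇ p) * (s * h p)) (oneTo m) + ∑ (λ p → h p * leafChildren p l + h p * leafChildren p r) (oneTo m)
      ≡⟨ cong₂ _+_ at-k (∑-+ _ _ (oneTo m)) ⟩
    s * h k + (∑ (λ p → h p * leafChildren p l) (oneTo m) + ∑ (λ p → h p * leafChildren p r) (oneTo m))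
      ≡⟨ cong (s * h k +_) (cong₂ _+_ (sym (leafParentSum≡∑leafChildren m h l inl)) (sym (leafParentSum≡∑leafChildren m h r inr))) ⟩
    s * h k + (leafParentSum h l + leafParentSum h r)
      ≡⟨ sym (ℕ.+-assoc (s * h k) _ _) ⟩
    leafParentSum h (node k l r) ∎)
  where
  open ≡-Reasoning
  s = isLeaf l + isLeaf r
  distribute : ∀ hp c s a b → hp * (c * s + a + b) ≡ c * (s * hp) + (hp * a + hp * b)
  distribute = solve-∀
  at-k : ∑ (λ p → χ (k ≡ᵇ p) * (s * h p)) (oneTo m) ≡ s * h k
  at-k = trans (∑-χ≡ᵇ k (λ p → s * h p) (oneTo m))
    (trans (cong (_* (s * h k)) (occurrences-oneTo m k 1≤k k≤m)) (ℕ.+-identityʳ _))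

mutual
  ∑marks-parentOf : ∀ K h k l r → Below K (node k l r) →
    ∑ (h ∘ parentOf K) (marks K (node k l r)) ≡ leafParentSum h (node k l r)
  ∑marks-parentOf K h k l r (k<K , bl , br) = begin
      ∑ (h ∘ parentOf K) (marks K (node k l r))
        ≡⟨ ∑-marks-node K (h ∘ parentOf K) k l r ⟩
      ∑ (λ x → h (parentOf K (node k x r))) (marks K l) + ∑ (λ y → h (parentOf K (node k l y))) (marks K r)
        ≡⟨ cong₂ _+_ (∑marks-parentOfˡ K h k l r bl br) (∑marks-parentOfʳ K h k l r bl br) ⟩
      (isLeaf l * h k + leafParentSum h l) + (isLeaf r * h k + leafParentSum h r)
        ≡⟨ collect (isLeaf l) (isLeaf r) (h k) (leafParentSum h l) (leafParentSum h r) ⟩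
      leafParentSum h (node k l r) ∎
    where
    open ≡-Reasoning
    collect : ∀ a b c x y → (a * c + x) + (b * c + y) ≡ (a + b) * c + x + y
    collect = solve-∀

  ∑marks-parentOfˡ : ∀ K h k l r → Below K l → Below K r →
    ∑ (λ x → h (parentOf K (node k x r))) (marks K l) ≡ isLeaf l * h k + leafParentSum h l
  ∑marks-parentOfˡ K h k leaf r _ br = cong (_+ 0) (trans (cong h (parentOf-cherryˡ K k r br)) (sym (ℕ.+-identityʳ (h k))))
  ∑marks-parentOfˡ K h k (node k' a b) r bl@(k'<K , _ , _) br = begin
      ∑ (λ x → h (parentOf K (node k x r))) (marks K (node k' a b))
        ≡⟨ ∑-marks-node K (λ x → h (parentOf K (node k x r))) k' a b ⟩
      ∑ (λ x → h (parentOf K (node k (node k' x b) r))) (marks K a) + ∑ (λ y → h (parentOf K (node k (node k' a y) r))) (marks K b)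
        ≡⟨ cong₂ _+_ (∑-cong (λ x → cong h (parentOf-nodeˡ K k k' x b r k'<K br)) (marks K a))
                     (∑-cong (λ y → cong h (parentOf-nodeˡ K k k' a y r k'<K br)) (marks K b)) ⟩
      ∑ (λ x → h (parentOf K (node k' x b))) (marks K a) + ∑ (λ y → h (parentOf K (node k' a y))) (marks K b)
        ≡⟨ sym (∑-marks-node K (h ∘ parentOf K) k' a b) ⟩
      ∑ (h ∘ parentOf K) (marks K (node k' a b))
        ≡⟨ ∑marks-parentOf K h k' a b bl ⟩
      leafParentSum h (node k' a b) ∎
    where open ≡-Reasoning

  ∑marks-parentOfʳ : ∀ K h k l r → Below K l → Below K r →
    ∑ (λ y → h (parentOf K (node k l y))) (marks K r) ≡ isLeaf r * h k + leafParentSum h r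
  ∑marks-parentOfʳ K h k l leaf bl _ = cong (_+ 0) (trans (cong h (parentOf-cherryʳ K k l bl)) (sym (ℕ.+-identityʳ (h k))))
  ∑marks-parentOfʳ K h k l (node k' a b) bl br@(k'<K , _ , _) = begin
      ∑ (λ y → h (parentOf K (node k l y))) (marks K (node k' a b))
        ≡⟨ ∑-marks-node K (λ y → h (parentOf K (node k l y))) k' a b ⟩
      ∑ (λ x → h (parentOf K (node k l (node k' x b)))) (marks K a) + ∑ (λ y → h (parentOf K (node k l (node k' a y)))) (marks K b)
        ≡⟨ cong₂ _+_ (∑-cong (λ x → cong h (parentOf-nodeʳ K k k' x b l k'<K bl)) (marks K a))
                     (∑-cong (λ y → cong h (parentOf-nodeʳ K k k' a y l k'<K bl)) (marks K b)) ⟩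
      ∑ (λ x → h (parentOf K (node k' x b))) (marks K a) + ∑ (λ y → h (parentOf K (node k' a y))) (marks K b)
        ≡⟨ sym (∑-marks-node K (h ∘ parentOf K) k' a b) ⟩
      ∑ (h ∘ parentOf K) (marks K (node k' a b))
        ≡⟨ ∑marks-parentOf K h k' a b br ⟩
      leafParentSum h (node k' a b) ∎
    where open ≡-Reasoning

marks-erase : ∀ K T → Below K T → All (λ x → erase K x ≡ T × OneCherry K x) (marks K T)
marks-erase K leaf _ = (erase-cherry K , here) ∷ []
marks-erase K (node k l r) (k<K , bl , br) = All.++⁺
  (All.map⁺ (All.map (λ {x} (x↦l , ox) → trans (erase-nodeˡ K k x r k<K br) (cong (λ l' → node k l' r) x↦l) , inLeft k<K ox br)
                     (marks-erase K l bl)))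
  (All.map⁺ (All.map (λ {x} (x↦r , ox) → trans (erase-nodeʳ K k l x k<K bl) (cong (node k l) x↦r) , inRight k<K bl ox)
                     (marks-erase K r br)))

marks-rank : ∀ K k l r → All (λ x → rank x ≡ k) (marks K (node k l r))
marks-rank K k l r = All.++⁺ (All.map⁺ (All.tabulate {xs = marks K l} (λ _ → refl)))
                             (All.map⁺ (All.tabulate {xs = marks K r} (λ _ → refl)))

length-merge : ∀ ls i j → i ℕ.< j → j ℕ.< length ls → length (merge ls (i , j)) ≡ pred (length ls)
length-merge ls i j i<j j<n = begin
    suc (length (removeAt (removeAt ls j) i)) ≡⟨ cong suc (length-removeAt (removeAt ls j) i i<n-1) ⟩
    suc (pred (length (removeAt ls j)))        ≡⟨ cong (suc ∘ pred) (length-removeAt ls j j<n) ⟩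
    suc (pred (pred (length ls)))              ≡⟨ ℕ.suc-pred (pred (length ls)) {{ℕ.>-nonZero (ℕ.≤-<-trans z≤n i<n-2)}} ⟩
    pred (length ls)                          ∎
  where
  open ≡-Reasoning
  i<n-2 : i ℕ.< pred (length ls)
  i<n-2 = ℕ.<-≤-trans i<j (ℕ.<⇒≤pred j<n)
  i<n-1 : i ℕ.< length (removeAt ls j)
  i<n-1 = ≡-subst (i ℕ.<_) (sym (length-removeAt ls j j<n)) i<n-2

pred<K : ∀ {n K} → 1 ≤ K → n ≤ K → pred n ℕ.< K
pred<K {zero} 1≤K _ = 1≤K
pred<K {suc n} _ n<K = n<K

All-run : (I : List RT → Set) (Q : RT → Set) →
  (∀ ls i j → I ls → i ℕ.< j → j ℕ.< length ls → I (merge ls (i , j))) →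
  (∀ T → I (T ∷ []) → Q T) →
  ∀ f ls → length ls ≡ suc f → I ls → All Q (run f ls)
All-run I Q I-merge I⇒Q zero (T ∷ []) refl I-T = I⇒Q T I-T ∷ []
All-run I Q I-merge I⇒Q (suc f) ls len I-ls = All.concat⁺ (All.map⁺ (All.map after-merge (pairs-ordered (length ls))))
  where
  after-merge : ∀ {(i , j) : ℕ × ℕ} → i ℕ.< j × j ℕ.< length ls → All Q (run f (merge ls (i , j)))
  after-merge {i , j} (i<j , j<n) =
    All-run I Q I-merge I⇒Q f (merge ls (i , j)) (trans (length-merge ls i j i<j j<n) (cong pred len)) (I-merge ls i j I-ls i<j j<n)

All-replicate : ∀ {P : RT → Set} n → P leaf → All P (replicate n leaf)
All-replicate zero _ = []
All-replicate (suc n) P-leaf = P-leaf ∷ All-replicate n P-leaf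

IsNode : RT → Set
IsNode leaf = ⊥
IsNode (node _ _ _) = ⊤

RanksIn-weaken : ∀ {lo lo' hi} T → lo' ≤ lo → RanksIn lo hi T → RanksIn lo' hi T
RanksIn-weaken leaf _ _ = tt
RanksIn-weaken (node k l r) lo'≤lo (lo≤k , k≤hi , inl , inr) =
  ℕ.≤-trans lo'≤lo lo≤k , k≤hi , RanksIn-weaken l lo'≤lo inl , RanksIn-weaken r lo'≤lo inr

-- With n lineages left all ranks created so far are ≥ n, and once a merge has happened the head lineage is a node.
CoalescentInvariant : ℕ → List RT → Set
CoalescentInvariant m ls = length ls ≤ suc m × All (RanksIn (length ls) m) ls × (length ls ≤ m → IsNode (nthT ls 0))

CoalescentInvariant-merge : ∀ m ls i j → CoalescentInvariant m ls → i ℕ.< j → j ℕ.< length ls →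
  CoalescentInvariant m (merge ls (i , j))
CoalescentInvariant-merge m ls i j (n≤1+m , ranks , _) i<j j<n rewrite length-merge ls i j i<j j<n =
  ℕ.≤-trans (ℕ.pred-mono-≤ n≤1+m) (ℕ.n≤1+n m) ,
  (ℕ.≤-refl , ℕ.pred-mono-≤ n≤1+m , weaken (All-nthT tt ranks i) , weaken (All-nthT tt ranks j))
    ∷ All.map weaken (All-removeAt (All-removeAt ranks j) i) ,
  λ _ → tt
  where
  weaken : ∀ {T} → RanksIn (length ls) m T → RanksIn (pred (length ls)) m T
  weaken = RanksIn-weaken _ ℕ.pred[n]≤n

coalescent-RanksIn : ∀ m → 1 ≤ m → All (λ T → RanksIn 1 m T × IsNode T) (coalescent m)
coalescent-RanksIn m 1≤m = All-run (CoalescentInvariant m) (λ T → RanksIn 1 m T × IsNode T) (CoalescentInvariant-merge m)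
  final m (replicate (suc m) leaf) (List.length-replicate (suc m)) initial
  where
  final : ∀ T → CoalescentInvariant m (T ∷ []) → RanksIn 1 m T × IsNode T
  final T (_ , inT ∷ [] , isNode) = inT , isNode 1≤m
  initial : CoalescentInvariant m (replicate (suc m) leaf)
  initial rewrite List.length-replicate (suc m) {leaf} = ℕ.≤-refl , All-replicate (suc m) tt , λ 1+m≤m → ⊥-elim (ℕ.1+n≰n 1+m≤m)

BelowOrCherry : ℕ → RT → Set
BelowOrCherry K leaf = ⊤
BelowOrCherry K (node k l r) = k ℕ.< K × BelowOrCherry K l × BelowOrCherry K r ⊎ node k l r ≡ cherry K

cherryCount : ℕ → RT → ℕ
cherryCount K leaf = 0
cherryCount K (node k l r) = χ (k ≡ᵇ K) + cherryCount K l + cherryCount K r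

BelowOrCherry⇒Below : ∀ K T → BelowOrCherry K T → cherryCount K T ≡ 0 → Below K T
BelowOrCherry⇒Below K leaf _ _ = tt
BelowOrCherry⇒Below K (node k l r) (inj₁ (k<K , bl , br)) count≡0 rewrite <⇒≡ᵇ≡false k<K =
  k<K , BelowOrCherry⇒Below K l bl (ℕ.m+n≡0⇒m≡0 (cherryCount K l) count≡0)
      , BelowOrCherry⇒Below K r br (ℕ.m+n≡0⇒n≡0 (cherryCount K l) count≡0)
BelowOrCherry⇒Below K (node .K .leaf .leaf) (inj₂ refl) count≡0 rewrite ≡ᵇ-refl K = ⊥-elim (ℕ.1+n≢0 count≡0)

BelowOrCherry⇒OneCherry : ∀ K T → BelowOrCherry K T → cherryCount K T ≡ 1 → OneCherry K T
BelowOrCherry⇒OneCherry K (node .K .leaf .leaf) (inj₂ refl) _ = here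
BelowOrCherry⇒OneCherry K (node k l r) (inj₁ (k<K , bl , br)) count≡1 rewrite <⇒≡ᵇ≡false k<K =
  split (cherryCount K l) refl count≡1
  where
  split : ∀ c → cherryCount K l ≡ c → c + cherryCount K r ≡ 1 → OneCherry K (node k l r)
  split zero l≡0 r≡1 = inRight k<K (BelowOrCherry⇒Below K l bl l≡0) (BelowOrCherry⇒OneCherry K r br r≡1)
  split (suc zero) l≡1 1+r≡1 = inLeft k<K (BelowOrCherry⇒OneCherry K l bl l≡1) (BelowOrCherry⇒Below K r br (ℕ.suc-injective 1+r≡1))

-- Invariant of the coalescent started from a cherry of rank K: it keeps exactly one rank-K node, a cherry.
MarkedInvariant : ℕ → List RT → Set
MarkedInvariant K ls = length ls ≤ K × All (BelowOrCherry K) ls × ∑ (cherryCount K) ls ≡ 1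

MarkedInvariant-merge : ∀ K ls i j → MarkedInvariant K ls → i ℕ.< j → j ℕ.< length ls → MarkedInvariant K (merge ls (i , j))
MarkedInvariant-merge K ls i j (n≤K , bcs , count≡1) i<j j<n =
  ≡-subst (_≤ K) (sym (length-merge ls i j i<j j<n)) (ℕ.≤-trans ℕ.pred[n]≤n n≤K) ,
  inj₁ (n-1<K , All-nthT tt bcs i , All-nthT tt bcs j) ∷ All-removeAt (All-removeAt bcs j) i ,
  trans merge-preserves-count count≡1
  where
  open ≡-Reasoning
  n-1<K : length ls ∸ 1 ℕ.< K
  n-1<K = pred<K (ℕ.≤-trans (s≤s z≤n) (ℕ.≤-trans j<n n≤K)) n≤K
  c = cherryCount K
  rest = ∑ c (removeAt (removeAt ls j) i)
  merge-preserves-count : ∑ c (merge ls (i , j)) ≡ ∑ c ls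
  merge-preserves-count = begin
      χ ((length ls ∸ 1) ≡ᵇ K) + c (nthT ls i) + c (nthT ls j) + ∑ c (removeAt (removeAt ls j) i)
        ≡⟨ cong (λ b → χ b + c (nthT ls i) + c (nthT ls j) + rest) (<⇒≡ᵇ≡false n-1<K) ⟩
      c (nthT ls i) + c (nthT ls j) + ∑ c (removeAt (removeAt ls j) i)
        ≡⟨ trans (cong (_+ rest) (ℕ.+-comm (c (nthT ls i)) _)) (ℕ.+-assoc (c (nthT ls j)) _ _) ⟩
      c (nthT ls j) + (c (nthT ls i) + ∑ c (removeAt (removeAt ls j) i))
        ≡⟨ cong (λ T → c (nthT ls j) + (c T + rest)) (sym (nthT-removeAt-< ls j i i<j)) ⟩
      c (nthT ls j) + (c (nthT (removeAt ls j) i) + ∑ c (removeAt (removeAt ls j) i))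
        ≡⟨ cong (c (nthT ls j) +_) (sym (∑-removeAt c refl (removeAt ls j) i)) ⟩
      c (nthT ls j) + ∑ c (removeAt ls j)
        ≡⟨ sym (∑-removeAt c refl ls j) ⟩
      ∑ c ls ∎

markedCoalescent : ℕ → List RT
markedCoalescent m = run m (cherry (suc m) ∷ replicate m leaf)

markedCoalescent-OneCherry : ∀ m → All (OneCherry (suc m)) (markedCoalescent m)
markedCoalescent-OneCherry m = All-run (MarkedInvariant (suc m)) (OneCherry (suc m)) (MarkedInvariant-merge (suc m))
  final m (cherry (suc m) ∷ replicate m leaf) (cong suc (List.length-replicate m)) initial
  where
  final : ∀ T → MarkedInvariant (suc m) (T ∷ []) → OneCherry (suc m) T
  final T (_ , bc ∷ [] , count≡1) = BelowOrCherry⇒OneCherry (suc m) T bc (trans (sym (ℕ.+-identityʳ _)) count≡1)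
  no-cherries : ∀ n → ∑ (cherryCount (suc m)) (replicate n leaf) ≡ 0
  no-cherries zero = refl
  no-cherries (suc n) = no-cherries n
  initial : MarkedInvariant (suc m) (cherry (suc m) ∷ replicate m leaf)
  initial = s≤s (ℕ.≤-reflexive (List.length-replicate m)) , inj₂ refl ∷ All-replicate m tt ,
            cong₂ _+_ (cong (λ b → χ b + 0 + 0) (≡ᵇ-refl m)) (no-cherries m)

concatMap-cong-All : ∀ {A B : Set} {f g : A → List B} {xs} → All (λ x → f x ≡ g x) xs → concatMap f xs ≡ concatMap g xs
concatMap-cong-All [] = refl
concatMap-cong-All (fx≡gx ∷ eqs) = cong₂ _++_ fx≡gx (concatMap-cong-All eqs)

nthT-map-erase : ∀ K ls i → nthT (map (erase K) ls) i ≡ erase K (nthT ls i)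
nthT-map-erase K [] i = refl
nthT-map-erase K (x ∷ ls) zero = refl
nthT-map-erase K (x ∷ ls) (suc i) = nthT-map-erase K ls i

merge-erase : ∀ K ls ij → 1 ≤ K → length ls ≤ K → map (erase K) (merge ls ij) ≡ merge (map (erase K) ls) ij
merge-erase K ls (i , j) 1≤K n≤K
  rewrite List.length-map (erase K) ls | erase-node K (length ls ∸ 1) (nthT ls i) (nthT ls j) (pred<K 1≤K n≤K)
        | nthT-map-erase K ls i | nthT-map-erase K ls j | removeAt-map (erase K) ls j | removeAt-map (erase K) (removeAt ls j) i
  = refl

run-erase : ∀ K → 1 ≤ K → ∀ f ls → length ls ≤ K → map (erase K) (run f ls) ≡ run f (map (erase K) ls)
run-erase K 1≤K zero ls n≤K = refl
run-erase K 1≤K (suc f) ls n≤K = begin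
    map (erase K) (concatMap (λ ij → run f (merge ls ij)) (pairs (length ls)))
      ≡⟨ List.map-concatMap (erase K) (λ ij → run f (merge ls ij)) (pairs (length ls)) ⟩
    concatMap (λ ij → map (erase K) (run f (merge ls ij))) (pairs (length ls))
      ≡⟨ concatMap-cong-All (All.map after-merge (pairs-ordered (length ls))) ⟩
    concatMap (λ ij → run f (merge (map (erase K) ls) ij)) (pairs (length ls))
      ≡⟨ cong (λ n → concatMap (λ ij → run f (merge (map (erase K) ls) ij)) (pairs n)) (sym (List.length-map (erase K) ls)) ⟩
    concatMap (λ ij → run f (merge (map (erase K) ls) ij)) (pairs (length (map (erase K) ls))) ∎
  where
  open ≡-Reasoning
  after-merge : ∀ {(i , j) : ℕ × ℕ} → i ℕ.< j × j ℕ.< length ls →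
    map (erase K) (run f (merge ls (i , j))) ≡ run f (merge (map (erase K) ls) (i , j))
  after-merge {i , j} (i<j , j<n) = trans
    (run-erase K 1≤K f (merge ls (i , j)) (≡-subst (_≤ K) (sym (length-merge ls i j i<j j<n)) (ℕ.≤-trans ℕ.pred[n]≤n n≤K)))
    (cong (run f) (merge-erase K ls (i , j) 1≤K n≤K))

erase-markedCoalescent : ∀ m → map (erase (suc m)) (markedCoalescent m) ≡ coalescent m
erase-markedCoalescent m = trans
  (run-erase (suc m) (s≤s z≤n) m (cherry (suc m) ∷ replicate m leaf) (s≤s (ℕ.≤-reflexive (List.length-replicate m))))
  (cong (run m) (cong₂ _∷_ (erase-cherry (suc m)) (map-erase-leaves m)))
  where
  map-erase-leaves : ∀ n → map (erase (suc m)) (replicate n leaf) ≡ replicate n leaf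
  map-erase-leaves zero = refl
  map-erase-leaves (suc n) = cong (leaf ∷_) (map-erase-leaves n)

nthT-replicate : ∀ n i → nthT (replicate n leaf) i ≡ leaf
nthT-replicate zero i = refl
nthT-replicate (suc n) zero = refl
nthT-replicate (suc n) (suc i) = nthT-replicate n i

removeAt-replicate : ∀ n i → i ≤ n → removeAt (replicate (suc n) leaf) i ≡ replicate n leaf
removeAt-replicate n zero _ = refl
removeAt-replicate (suc n) (suc i) (s≤s i≤n) = cong (leaf ∷_) (removeAt-replicate n i i≤n)

merge-replicate : ∀ m i j → i ℕ.< j → j ℕ.< suc (suc m) →
  merge (replicate (suc (suc m)) leaf) (i , j) ≡ cherry (suc m) ∷ replicate m leaf
merge-replicate m i j i<j j<2+m
  rewrite List.length-replicate m {leaf} | nthT-replicate (suc (suc m)) i | nthT-replicate (suc (suc m)) j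
        | removeAt-replicate (suc m) j (ℕ.<⇒≤pred j<2+m)
        | removeAt-replicate m i (ℕ.<⇒≤pred (ℕ.<-≤-trans i<j (ℕ.<⇒≤pred j<2+m)))
  = refl

-- The first merge always joins two leaves into a cherry of rank m + 1.
coalescent-suc : ∀ m → coalescent (suc m) ≡ concatMap (λ _ → markedCoalescent m) (pairs (suc (suc m)))
coalescent-suc m = trans
  (cong (λ n → concatMap (λ ij → run m (merge (replicate (suc (suc m)) leaf) ij)) (pairs n)) (List.length-replicate (suc (suc m))))
  (concatMap-cong-All (All.map (λ {(i , j)} (i<j , j<n) → cong (run m) (merge-replicate m i j i<j j<n)) (pairs-ordered (suc (suc m)))))

∑-coalescent-suc : ∀ m (u : RT → ℕ) → ∑ u (coalescent (suc m)) ≡ length (pairs (suc (suc m))) * ∑ u (markedCoalescent m)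
∑-coalescent-suc m u = trans (cong (∑ u) (coalescent-suc m))
  (trans (∑-concatMap u (λ _ → markedCoalescent m) (pairs (suc (suc m)))) (∑-const (∑ u (markedCoalescent m)) (pairs (suc (suc m)))))

All-coalescent-suc : ∀ m {Q : RT → Set} → All Q (markedCoalescent m) → All Q (coalescent (suc m))
All-coalescent-suc m {Q} all-Q = ≡-subst (All Q) (sym (coalescent-suc m))
  (All.concat⁺ (All.map⁺ (All.tabulate {xs = pairs (suc (suc m))} (λ _ → all-Q))))

length-coalescent : ∀ m → 2 ^ m * length (coalescent m) ≡ suc m ! * m !
length-coalescent zero = refl
length-coalescent (suc m) = begin
    2 ^ suc m * length (coalescent (suc m))
      ≡⟨ cong (2 ^ suc m *_) (trans (length≡∑1 (coalescent (suc m))) (∑-coalescent-suc m (λ _ → 1))) ⟩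
    2 ^ suc m * (P * ∑ (λ _ → 1) (markedCoalescent m))
      ≡⟨ cong (λ n → 2 ^ suc m * (P * n)) (sym (length≡∑1 (markedCoalescent m))) ⟩
    2 ^ suc m * (P * length (markedCoalescent m))
      ≡⟨ cong (λ n → 2 ^ suc m * (P * n))
              (trans (sym (List.length-map (erase (suc m)) (markedCoalescent m))) (cong length (erase-markedCoalescent m))) ⟩
    2 ^ suc m * (P * length (coalescent m))
      ≡⟨ regroup (2 ^ m) P (length (coalescent m)) ⟩
    (2 * P) * (2 ^ m * length (coalescent m))
      ≡⟨ cong₂ _*_ (2*length-pairs (suc (suc m))) (length-coalescent m) ⟩
    (suc (suc m) * suc m) * (suc m ! * m !)
      ≡⟨ factorials m (suc m !) (m !) ⟩
    suc (suc m) * suc m ! * (suc m * m !) ∎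
  where
  open ≡-Reasoning
  P = length (pairs (suc (suc m)))
  regroup : ∀ x p y → 2 * x * (p * y) ≡ (2 * p) * (x * y)
  regroup = solve-∀
  factorials : ∀ m f g → (suc (suc m) * suc m) * (f * g) ≡ suc (suc m) * f * (suc m * g)
  factorials = solve-∀

ρmax-split : ∀ m T → OneCherry (suc (suc m)) T →
  ρmax (suc (suc m)) T ≡ ρmax (suc m) (erase (suc (suc m)) T) ++ parentOf (suc (suc m)) T ∷ []
ρmax-split m T oT = trans (List.map-++ (maxParent (edges T)) (range 2 (suc (suc m))) (suc (suc m) ∷ []))
  (cong (_++ parentOf (suc (suc m)) T ∷ [])
        (List.map-cong-local (All.map (λ i<K → parentOf-erase oT _ (ℕ.<⇒≢ i<K)) (range-< 2 (suc (suc m))))))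

ρ-split : ∀ m T → OneCherry (suc (suc m)) T → rank T ≢ suc (suc m) →
  ρ (suc (suc m)) T ≡ ρ (suc m) (erase (suc (suc m)) T) ++ parentOf (suc (suc m)) T ∷ []
ρ-split m T oT rank≢ = trans (List.map-++ (lookupParent (edges T)) (range 2 (suc (suc m))) (suc (suc m) ∷ []))
  (cong₂ _++_ (List.map-cong-local (All.map (λ i<K → lookupParent-erase oT _ (ℕ.<⇒≢ i<K)) (range-< 2 (suc (suc m)))))
              (cong (_∷ []) (lookupParent-OneCherry oT rank≢)))

-- Every internal node has two children, each either a leaf of T or a node of ρ T.
Coherent : ℕ → RT → Set
Coherent m T = (∀ p → 1 ≤ p → p ≤ m → leafChildren p T + occurrences p (ρmax m T) ≡ 2) × ρ m T ≡ ρmax m T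

rank≢-erase : ∀ K T → IsNode (erase K T) → rank T ≢ K
rank≢-erase K (node k l r) isNode with k ≡ᵇ K | ≡ᵇ-view k K
rank≢-erase K (node k l r) () | .true | equal _
... | .false | different k≢K = k≢K

Coherent-erase : ∀ m T → OneCherry (suc (suc m)) T → let eT = erase (suc (suc m)) T in
  Coherent (suc m) eT → RanksIn 1 (suc m) eT → IsNode eT → Coherent (suc (suc m)) T
Coherent-erase m T oT (counts , ρ≡ρmax) inT isNode = counts′ , ρ≡ρmax′
  where
  K = suc (suc m)
  eT = erase K T
  rank≢K : rank T ≢ K
  rank≢K = rank≢-erase K T isNode
  ρ≡ρmax′ : ρ K T ≡ ρmax K T
  ρ≡ρmax′ = trans (ρ-split m T oT rank≢K) (trans (cong (_++ parentOf K T ∷ []) ρ≡ρmax) (sym (ρmax-split m T oT)))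
  ρmax-< : All (ℕ._< K) (ρmax (suc m) eT ++ parentOf K T ∷ [])
  ρmax-< = All.++⁺ (All.map⁺ (All.tabulate (λ {i} _ → s≤s (parentOf-≤ eT inT i))))
                   (s≤s (proj₂ (parentOf-bounds oT rank≢K inT)) ∷ [])
  counts′ : ∀ p → 1 ≤ p → p ≤ K → leafChildren p T + occurrences p (ρmax K T) ≡ 2
  counts′ p 1≤p p≤K with ℕ.m≤n⇒m<n∨m≡n p≤K
  ... | inj₂ refl rewrite leafChildren-OneCherry oT | ρmax-split m T oT | occurrences-absent K _ ρmax-< = refl
  ... | inj₁ (s≤s p≤1+m) = begin
      leafChildren p T + occurrences p (ρmax K T)
        ≡⟨ cong (λ t → leafChildren p T + occurrences p t) (ρmax-split m T oT) ⟩
      leafChildren p T + occurrences p (ρmax (suc m) eT ++ parentOf K T ∷ [])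
        ≡⟨ cong (leafChildren p T +_) (occurrences-∷ʳ p (ρmax (suc m) eT) (parentOf K T)) ⟩
      leafChildren p T + (occurrences p (ρmax (suc m) eT) + χ (p ≡ᵇ parentOf K T))
        ≡⟨ cong (λ b → leafChildren p T + (occurrences p (ρmax (suc m) eT) + χ b)) (≡ᵇ-sym p (parentOf K T)) ⟩
      leafChildren p T + (occurrences p (ρmax (suc m) eT) + χ (parentOf K T ≡ᵇ p))
        ≡⟨ +-CS.x∙yz≈xz∙y (leafChildren p T) _ _ ⟩
      (leafChildren p T + χ (parentOf K T ≡ᵇ p)) + occurrences p (ρmax (suc m) eT)
        ≡⟨ cong (_+ occurrences p (ρmax (suc m) eT)) (sym (leafChildren-erase oT p (ℕ.>⇒≢ 1≤p) (ℕ.<⇒≢ (s≤s p≤1+m)))) ⟩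
      leafChildren p eT + occurrences p (ρmax (suc m) eT)
        ≡⟨ counts p 1≤p p≤1+m ⟩
      2 ∎
    where open ≡-Reasoning

∑attach : ℕ → (List ℕ → ℕ) → List ℕ → ℕ
∑attach m g t = ∑ (λ p → g (t ++ p ∷ []) * (2 ∸ occurrences p t)) (oneTo m)

-- Vanishes on trees without a rank m + 1 node, as the marking lemma requires.
markWeight : ℕ → (List ℕ → ℕ) → RT → ℕ
markWeight m g T = if parentOf (suc m) T ≡ᵇ 0 then 0 else g (ρmax (suc m) T)

markWeight-≈-Invariant : ∀ m g → ≈-Invariant (markWeight m g)
markWeight-≈-Invariant m g x≈y rewrite parentOf-≈ (suc m) x≈y | ρmax-≈ (suc m) x≈y = refl

markWeight-Below : ∀ m g T → Below (suc m) T → markWeight m g T ≡ 0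
markWeight-Below m g T bT rewrite parentOf-Below (suc m) T bT = refl

markWeight-OneCherry : ∀ m g T → OneCherry (suc (suc m)) T → rank T ≢ suc (suc m) →
  RanksIn 1 (suc m) (erase (suc (suc m)) T) →
  markWeight (suc m) g T ≡ g (ρmax (suc (suc m)) T)
markWeight-OneCherry m g T oT rank≢ inT
  rewrite ≢⇒≡ᵇ≡false (ℕ.>⇒≢ (proj₁ (parentOf-bounds oT rank≢ inT))) = refl

∑marks-markWeight : ∀ m g T → RanksIn 1 (suc m) T → IsNode T → Coherent (suc m) T →
  ∑ (markWeight (suc m) g) (marks (suc (suc m)) T) ≡ ∑attach (suc m) g (ρmax (suc m) T)
∑marks-markWeight m g T@(node k l r) inT _ (counts , _) = begin
    ∑ (markWeight (suc m) g) (marks K T)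
      ≡⟨ ∑-cong-All (All.zipWith attach (marks-erase K T bT , marks-rank K k l r)) ⟩
    ∑ (λ x → h (parentOf K x)) (marks K T)
      ≡⟨ ∑marks-parentOf K h k l r bT ⟩
    leafParentSum h T
      ≡⟨ leafParentSum≡∑leafChildren (suc m) h T inT ⟩
    ∑ (λ p → h p * leafChildren p T) (oneTo (suc m))
      ≡⟨ ∑-cong-All (All.map (λ {p} (1≤p , p≤1+m) → cong (h p *_) (free-slots p 1≤p p≤1+m)) (oneTo-bounds (suc m))) ⟩
    ∑attach (suc m) g (ρmax (suc m) T) ∎
  where
  open ≡-Reasoning
  K = suc (suc m)
  bT : Below K T
  bT = RanksIn⇒Below T ℕ.≤-refl inT
  h : ℕ → ℕ
  h p = g (ρmax (suc m) T ++ p ∷ [])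
  attach : ∀ {x} → (erase K x ≡ T × OneCherry K x) × rank x ≡ k → markWeight (suc m) g x ≡ h (parentOf K x)
  attach {x} ((x↦T , ox) , rank≡k) = trans (markWeight-OneCherry m g x ox rank≢K (≡-subst (RanksIn 1 (suc m)) (sym x↦T) inT))
    (cong g (trans (ρmax-split m x ox) (cong (λ t → ρmax (suc m) t ++ parentOf K x ∷ []) x↦T)))
    where
    rank≢K : rank x ≢ K
    rank≢K = ≡-subst (_≢ K) (sym rank≡k) (ℕ.<⇒≢ (proj₁ bT))
  free-slots : ∀ p → 1 ≤ p → p ≤ suc m → leafChildren p T ≡ 2 ∸ occurrences p (ρmax (suc m) T)
  free-slots p 1≤p p≤1+m = trans (sym (ℕ.m+n∸n≡m (leafChildren p T) (occurrences p (ρmax (suc m) T))))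
    (cong (_∸ occurrences p (ρmax (suc m) T)) (counts p 1≤p p≤1+m))

∏ : {A : Set} → (A → ℕ) → List A → ℕ
∏ f [] = 1
∏ f (x ∷ xs) = f x * ∏ f xs

-- The weight 2 ^ [d > 0] of a node with d children, set to 0 when d > 2 so that only 0-1-2 trees count.
childWeight : ℕ → ℕ
childWeight 0 = 1
childWeight 1 = 2
childWeight 2 = 2
childWeight (suc (suc (suc _))) = 0

childWeight-suc : ∀ d → childWeight (suc d) ≡ childWeight d * (2 ∸ d)
childWeight-suc 0 = refl
childWeight-suc 1 = refl
childWeight-suc 2 = refl
childWeight-suc (suc (suc (suc d))) = refl

private
  doubling : ∀ {c L C p} → C ≤ L → c * 2 ^ (L ∸ C) ≡ p → c * 2 ^ (suc L ∸ C) ≡ 2 * p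
  doubling {c} {L} {C} C≤L eq rewrite ℕ.+-∸-assoc 1 C≤L =
    trans (ℕ.*-comm c (2 * 2 ^ (L ∸ C))) (trans (ℕ.*-assoc 2 (2 ^ (L ∸ C)) c) (cong (2 *_) (trans (ℕ.*-comm (2 ^ (L ∸ C)) c) eq)))

∏childWeight : ∀ (f : ℕ → ℕ) xs →
  χ (count (λ i → not (f i ≤ᵇ 2)) xs ≡ᵇ 0) * 2 ^ (length xs ∸ count (λ i → f i ≡ᵇ 0) xs) ≡ ∏ (childWeight ∘ f) xs
∏childWeight f [] = refl
∏childWeight f (x ∷ xs) with f x | ∏childWeight f xs
... | 0 | ih = trans ih (sym (ℕ.+-identityʳ _))
... | 1 | ih = doubling {χ (count (λ i → not (f i ≤ᵇ 2)) xs ≡ᵇ 0)} (List.length-filter (λ i → (f i ≡ᵇ 0) Data.Bool.≟ true) xs) ih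
... | 2 | ih = doubling {χ (count (λ i → not (f i ≤ᵇ 2)) xs ≡ᵇ 0)} (List.length-filter (λ i → (f i ≡ᵇ 0) Data.Bool.≟ true) xs) ih
... | suc (suc (suc _)) | _ = refl

∏-update : ∀ p (f : ℕ → ℕ) xs →
  ∏ (λ i → childWeight (f i + χ (i ≡ᵇ p))) xs ≡ ∏ (childWeight ∘ f) xs * (2 ∸ f p) ^ occurrences p xs
∏-update p f [] = refl
∏-update p f (x ∷ xs) with x ≡ᵇ p | ≡ᵇ-view x p | ∏-update p f xs
... | .true | equal refl | ih rewrite ≡ᵇ-refl x = begin
    childWeight (f x + 1) * ∏ (λ i → childWeight (f i + χ (i ≡ᵇ x))) xs
      ≡⟨ cong₂ _*_ (trans (cong childWeight (ℕ.+-comm (f x) 1)) (childWeight-suc (f x))) ih ⟩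
    childWeight (f x) * (2 ∸ f x) * (∏ (childWeight ∘ f) xs * (2 ∸ f x) ^ occurrences x xs)
      ≡⟨ rearrange (childWeight (f x)) (2 ∸ f x) _ _ ⟩
    childWeight (f x) * ∏ (childWeight ∘ f) xs * ((2 ∸ f x) * (2 ∸ f x) ^ occurrences x xs) ∎
  where
  open ≡-Reasoning
  rearrange : ∀ a b c d → a * b * (c * d) ≡ a * c * (b * d)
  rearrange = solve-∀
... | .false | different x≢p | ih rewrite ≢⇒≡ᵇ≡false (x≢p ∘ sym) = begin
    childWeight (f x + 0) * ∏ (λ i → childWeight (f i + χ (i ≡ᵇ p))) xs
      ≡⟨ cong₂ _*_ (cong childWeight (ℕ.+-identityʳ (f x))) ih ⟩
    childWeight (f x) * (∏ (childWeight ∘ f) xs * (2 ∸ f p) ^ occurrences p xs)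
      ≡⟨ sym (ℕ.*-assoc (childWeight (f x)) _ _) ⟩
    childWeight (f x) * ∏ (childWeight ∘ f) xs * (2 ∸ f p) ^ occurrences p xs ∎
  where open ≡-Reasoning

∏-cong : {A : Set} {f g : A → ℕ} → (∀ x → f x ≡ g x) → (xs : List A) → ∏ f xs ≡ ∏ g xs
∏-cong f≗g [] = refl
∏-cong f≗g (x ∷ xs) = cong₂ _*_ (f≗g x) (∏-cong f≗g xs)

∏-++ : {A : Set} (f : A → ℕ) (xs ys : List A) → ∏ f (xs ++ ys) ≡ ∏ f xs * ∏ f ys
∏-++ f [] ys = sym (ℕ.+-identityʳ (∏ f ys))
∏-++ f (x ∷ xs) ys = trans (cong (f x *_) (∏-++ f xs ys)) (sym (ℕ.*-assoc (f x) (∏ f xs) (∏ f ys)))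

nodeWeight : ℕ → List ℕ → ℕ
nodeWeight m t = ∏ (λ i → childWeight (occurrences i t)) (oneTo m)

χis012*2^≡nodeWeight : ∀ m t → χ (is012 m t) * 2 ^ (m ∸ o m t) ≡ nodeWeight m t
χis012*2^≡nodeWeight m t =
  trans (cong (λ n → χ (is012 m t) * 2 ^ (n ∸ o m t)) (sym (length-oneTo m))) (∏childWeight (λ i → occurrences i t) (oneTo m))

-- Attaching node m + 1 below p changes only the factor of p, whose outdegree grows by one.
nodeWeight-attach : ∀ m s p → All (ℕ._< suc m) s → 1 ≤ p → p ≤ m →
  nodeWeight (suc m) (s ++ p ∷ []) ≡ nodeWeight m s * (2 ∸ occurrences p s)
nodeWeight-attach m s p s<1+m 1≤p p≤m = begin
    nodeWeight (suc m) (s ++ p ∷ [])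
      ≡⟨ ∏-++ (λ i → childWeight (occurrences i (s ++ p ∷ []))) (oneTo m) (suc m ∷ []) ⟩
    ∏ (λ i → childWeight (occurrences i (s ++ p ∷ []))) (oneTo m) * (childWeight (occurrences (suc m) (s ++ p ∷ [])) * 1)
      ≡⟨ cong₂ _*_ (∏-cong (λ i → cong childWeight (occurrences-∷ʳ i s p)) (oneTo m)) new-node-is-leaf ⟩
    ∏ (λ i → childWeight (occurrences i s + χ (i ≡ᵇ p))) (oneTo m) * 1
      ≡⟨ ℕ.*-identityʳ _ ⟩
    ∏ (λ i → childWeight (occurrences i s + χ (i ≡ᵇ p))) (oneTo m)
      ≡⟨ ∏-update p (λ i → occurrences i s) (oneTo m) ⟩
    nodeWeight m s * (2 ∸ occurrences p s) ^ occurrences p (oneTo m)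
      ≡⟨ cong (λ n → nodeWeight m s * (2 ∸ occurrences p s) ^ n) (occurrences-oneTo m p 1≤p p≤m) ⟩
    nodeWeight m s * ((2 ∸ occurrences p s) * 1)
      ≡⟨ cong (nodeWeight m s *_) (ℕ.*-identityʳ _) ⟩
    nodeWeight m s * (2 ∸ occurrences p s) ∎
  where
  open ≡-Reasoning
  new-node-is-leaf : childWeight (occurrences (suc m) (s ++ p ∷ [])) * 1 ≡ 1
  new-node-is-leaf rewrite occurrences-absent (suc m) (s ++ p ∷ []) (All.++⁺ s<1+m (s≤s p≤m ∷ [])) = refl

parentLists-bounded : ∀ n → All (All (ℕ._< suc n)) (parentLists (suc n))
parentLists-bounded zero = [] ∷ []
parentLists-bounded (suc n) = All.concat⁺ (All.map⁺ (All.map extend (parentLists-bounded n)))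
  where
  extend : ∀ {s} → All (ℕ._< suc n) s → All (All (ℕ._< suc (suc n))) (map (λ p → s ++ p ∷ []) (oneTo (suc n)))
  extend s<1+n = All.map⁺ (All.map (λ (_ , p≤1+n) → All.++⁺ (All.map ℕ.m<n⇒m<1+n s<1+n) (s≤s p≤1+n ∷ []))
                                   (oneTo-bounds (suc n)))

weightedCount : ℕ → (List ℕ → ℕ) → ℕ
weightedCount m g = ∑ (λ t → g t * nodeWeight m t) (parentLists m)

weightedCount-suc : ∀ n g → weightedCount (suc n) (∑attach (suc n) g) ≡ weightedCount (suc (suc n)) g
weightedCount-suc n g = begin
    ∑ (λ s → ∑attach m g s * nodeWeight m s) (parentLists m)
      ≡⟨ ∑-cong-All (All.map attach-all (parentLists-bounded n)) ⟩
    ∑ (λ s → ∑ (λ p → F (s ++ p ∷ [])) (oneTo m)) (parentLists m)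
      ≡⟨ ∑-cong (λ s → sym (∑-map F (λ p → s ++ p ∷ []) (oneTo m))) (parentLists m) ⟩
    ∑ (λ s → ∑ F (map (λ p → s ++ p ∷ []) (oneTo m))) (parentLists m)
      ≡⟨ sym (∑-concatMap F (λ s → map (λ p → s ++ p ∷ []) (oneTo m)) (parentLists m)) ⟩
    weightedCount (suc m) g ∎
  where
  open ≡-Reasoning
  m = suc n
  F : List ℕ → ℕ
  F t = g t * nodeWeight (suc m) t
  attach-all : ∀ {s} → All (ℕ._< m) s → ∑attach m g s * nodeWeight m s ≡ ∑ (λ p → F (s ++ p ∷ [])) (oneTo m)
  attach-all {s} s<m = trans (sym (∑-*ʳ (nodeWeight m s) _ (oneTo m))) (∑-cong-All (All.map attach (oneTo-bounds m)))
    where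
    attach : ∀ {p} → 1 ≤ p × p ≤ m → g (s ++ p ∷ []) * (2 ∸ occurrences p s) * nodeWeight m s ≡ F (s ++ p ∷ [])
    attach {p} (1≤p , p≤m) = begin
        g (s ++ p ∷ []) * (2 ∸ occurrences p s) * nodeWeight m s
          ≡⟨ trans (ℕ.*-assoc (g (s ++ p ∷ [])) _ _) (cong (g (s ++ p ∷ []) *_) (ℕ.*-comm (2 ∸ occurrences p s) _)) ⟩
        g (s ++ p ∷ []) * (nodeWeight m s * (2 ∸ occurrences p s))
          ≡⟨ cong (g (s ++ p ∷ []) *_) (sym (nodeWeight-attach m s p (All.map ℕ.m<n⇒m<1+n s<m) 1≤p p≤m)) ⟩
        F (s ++ p ∷ []) ∎

All-erase-markedCoalescent : ∀ m {Q : RT → Set} → All Q (coalescent m) → All (Q ∘ erase (suc m)) (markedCoalescent m)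
All-erase-markedCoalescent m {Q} all-Q = All.map⁻ (≡-subst (All Q) (sym (erase-markedCoalescent m)) all-Q)

coalescent-Coherent : ∀ n → All (Coherent (suc n)) (coalescent (suc n))
coalescent-Coherent zero = (coherent , refl) ∷ []
  where
  coherent : ∀ p → 1 ≤ p → p ≤ 1 → leafChildren p (node 1 leaf leaf) + occurrences p [] ≡ 2
  coherent 1 _ _ = refl
  coherent (suc (suc p)) _ (s≤s ())
coalescent-Coherent (suc n) = All-coalescent-suc (suc n) (All.zipWith erase-step
  (markedCoalescent-OneCherry (suc n) ,
   All.zipWith (λ x → x) (All-erase-markedCoalescent (suc n) (coalescent-Coherent n) ,
                          All-erase-markedCoalescent (suc n) (coalescent-RanksIn (suc n) (s≤s z≤n)))))
  where
  erase-step : ∀ {T} → OneCherry (suc (suc n)) T × Coherent (suc n) (erase _ T) × RanksIn 1 (suc n) (erase _ T) × IsNode (erase _ T) →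
    Coherent (suc (suc n)) T
  erase-step {T} (oT , coh , inT , isNode) = Coherent-erase n T oT coh inT isNode

-- Averaging over the position of the first cherry turns the marked coalescent into the coalescent with one extra leaf marked.
∑markedCoalescent : ∀ n g → suc (suc n) * ∑ (g ∘ ρmax (suc (suc n))) (markedCoalescent (suc n)) ≡
  ∑ (∑attach (suc n) g ∘ ρmax (suc n)) (coalescent (suc n))
∑markedCoalescent n g = begin
    suc m * ∑ (g ∘ ρmax K) (markedCoalescent m)
      ≡⟨ cong (suc m *_) (∑-cong-All (All.zipWith weight-of-marked
           (markedCoalescent-OneCherry m , All-erase-markedCoalescent m (coalescent-RanksIn m (s≤s z≤n))))) ⟩
    suc m * ∑run w m (cherry K ∷ replicate m leaf)
      ≡⟨ sym (∑marksList-replicate K w-inv m m) ⟩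
    ∑ (∑run w m) (marksList K (replicate (suc m) leaf))
      ≡⟨ ∑marksList-run K w w-inv (markWeight-Below m g) m (All-replicate (suc m) tt) (ℕ.≤-reflexive (List.length-replicate (suc m))) ⟩
    ∑ (markSum K w) (coalescent m)
      ≡⟨ ∑-cong-All (All.zipWith (λ ((inT , isNode) , coh) → ∑marks-markWeight n g _ inT isNode coh)
                                 (coalescent-RanksIn m (s≤s z≤n) , coalescent-Coherent n)) ⟩
    ∑ (∑attach m g ∘ ρmax m) (coalescent m) ∎
  where
  open ≡-Reasoning
  m = suc n
  K = suc m
  w = markWeight m g
  w-inv = markWeight-≈-Invariant m g
  weight-of-marked : ∀ {T} → OneCherry K T × RanksIn 1 m (erase K T) × IsNode (erase K T) → g (ρmax K T) ≡ w T
  weight-of-marked {T} (oT , inT , isNode) = sym (markWeight-OneCherry n g T oT (rank≢-erase K T isNode) inT)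

coalescent-count : ∀ n g → 2 ^ suc n * ∑ (g ∘ ρmax (suc n)) (coalescent (suc n)) ≡ suc (suc n) ! * weightedCount (suc n) g
coalescent-count zero g = solve (g [])
  where
  solve : ∀ x → 2 * (x + 0) ≡ 2 * (x * 1 + 0)
  solve = solve-∀
coalescent-count (suc n) g = begin
    2 ^ suc m * ∑ (g ∘ ρmax (suc m)) (coalescent (suc m))
      ≡⟨ cong (2 ^ suc m *_) (∑-coalescent-suc m (g ∘ ρmax (suc m))) ⟩
    2 ^ suc m * (P * X)
      ≡⟨ regroup (2 ^ m) P X ⟩
    2 ^ m * ((2 * P) * X)
      ≡⟨ cong (λ p → 2 ^ m * (p * X)) (2*length-pairs (suc (suc m))) ⟩
    2 ^ m * ((suc (suc m) * suc m) * X)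
      ≡⟨ regroup′ (2 ^ m) (suc (suc m)) (suc m) X ⟩
    suc (suc m) * (2 ^ m * (suc m * X))
      ≡⟨ cong (λ x → suc (suc m) * (2 ^ m * x)) (∑markedCoalescent n g) ⟩
    suc (suc m) * (2 ^ m * ∑ (∑attach m g ∘ ρmax m) (coalescent m))
      ≡⟨ cong (suc (suc m) *_) (coalescent-count n (∑attach m g)) ⟩
    suc (suc m) * (suc m ! * weightedCount m (∑attach m g))
      ≡⟨ trans (sym (ℕ.*-assoc (suc (suc m)) (suc m !) _)) (cong (suc (suc m) ! *_) (weightedCount-suc n g)) ⟩
    suc (suc m) ! * weightedCount (suc m) g ∎
  where
  open ≡-Reasoning
  m = suc n
  P = length (pairs (suc (suc m)))
  X = ∑ (g ∘ ρmax (suc m)) (markedCoalescent m)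
  regroup : ∀ x p y → 2 * x * (p * y) ≡ x * ((2 * p) * y)
  regroup = solve-∀
  regroup′ : ∀ x a b y → x * ((a * b) * y) ≡ a * (x * (b * y))
  regroup′ = solve-∀

weightedCount≡∑I012 : ∀ m h → weightedCount m h ≡ ∑ (λ t → h t * 2 ^ (m ∸ o m t)) (I012 m)
weightedCount≡∑I012 m h = sym (trans (∑-filter _ (is012 m) (parentLists m)) (∑-cong summand (parentLists m)))
  where
  summand : ∀ t → χ (is012 m t) * (h t * 2 ^ (m ∸ o m t)) ≡ h t * nodeWeight m t
  summand t = trans (*-CS.x∙yz≈y∙xz (χ (is012 m t)) (h t) _) (cong (h t *_) (χis012*2^≡nodeWeight m t))

count-ρT : ∀ n B → 2 ^ suc n * count B (ρT (suc n)) ≡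
  suc (suc n) ! * ∑ (λ t → χ (B t) * 2 ^ (suc n ∸ o (suc n) t)) (I012 (suc n))
count-ρT n B = begin
    2 ^ m * count B (ρT m)
      ≡⟨ cong (2 ^ m *_) (trans (count≡∑χ B (ρT m)) (∑-map (χ ∘ B) (ρ m) (coalescent m))) ⟩
    2 ^ m * ∑ (χ ∘ B ∘ ρ m) (coalescent m)
      ≡⟨ cong (2 ^ m *_) (∑-cong-All (All.map (cong (χ ∘ B) ∘ proj₂) (coalescent-Coherent n))) ⟩
    2 ^ m * ∑ (χ ∘ B ∘ ρmax m) (coalescent m)
      ≡⟨ coalescent-count n (χ ∘ B) ⟩
    suc m ! * weightedCount m (χ ∘ B)
      ≡⟨ cong (suc m ! *_) (weightedCount≡∑I012 m (χ ∘ B)) ⟩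
    suc m ! * ∑ (λ t → χ (B t) * 2 ^ (m ∸ o m t)) (I012 m) ∎
  where
  open ≡-Reasoning
  m = suc n

length-ρT : ∀ m → 2 ^ m * length (ρT m) ≡ suc m ! * m !
length-ρT m = trans (cong (2 ^ m *_) (List.length-map (ρ m) (coalescent m))) (length-coalescent m)

length-ρT-nonZero : ∀ m → ℕ.NonZero (length (ρT m))
length-ρT-nonZero m with length (ρT m) | length-ρT m
... | zero | 2^m*0≡ = ⊥-elim (ℕ.≢-nonZero⁻¹ (suc m ! * m !) {{ℕ.m*n≢0 _ _ {{suc m !≢0}} {{m !≢0}}}}
                                          (trans (sym 2^m*0≡) (ℕ.*-zeroʳ (2 ^ m))))
... | suc _ | _ = _

count-filter : ∀ {A : Set} (F E : A → Bool) xs →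
  count E (filter (λ x → F x Data.Bool.≟ true) xs) ≡ count (λ x → F x ∧ E x) xs
count-filter F E xs = begin
    count E (filter (λ x → F x Data.Bool.≟ true) xs) ≡⟨ count≡∑χ E (filter (λ x → F x Data.Bool.≟ true) xs) ⟩
    ∑ (χ ∘ E) (filter (λ x → F x Data.Bool.≟ true) xs) ≡⟨ ∑-filter (χ ∘ E) F xs ⟩
    ∑ (λ x → χ (F x) * χ (E x)) xs                     ≡⟨ ∑-cong (λ x → sym (χ-∧ (F x) (E x))) xs ⟩
    ∑ (λ x → χ (F x ∧ E x)) xs                         ≡⟨ sym (count≡∑χ (λ x → F x ∧ E x) xs) ⟩
    count (λ x → F x ∧ E x) xs                         ∎
  where open ≡-Reasoning

≡ᵇ-1* : ∀ x y → (y ≡ᵇ 1 * x) ≡ (x ≡ᵇ y)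
≡ᵇ-1* x y rewrite ℕ.*-identityˡ x = ≡ᵇ-sym y x

module _ where
  open import Data.Integer as ℤ using (+_)
  import Data.Integer.Properties as ℤ

  /-cross : ∀ a b c d .{{_ : ℕ.NonZero b}} .{{_ : ℕ.NonZero d}} → a * d ≡ c * b → + a / b ≡ + c / d
  /-cross a (suc b) c (suc d) ad≡cb = ℚ.fromℚᵘ-cong {ℚᵘ.mkℚᵘ (+ a) b} {ℚᵘ.mkℚᵘ (+ c) d}
    (ℚᵘ.*≡* (trans (sym (ℤ.pos-* a (suc d))) (trans (cong +_ ad≡cb) (ℤ.pos-* c (suc b)))))

  private
    toℚᵘ-/ : ∀ a b → ℚ.toℚᵘ (+ a / suc b) ℚᵘ.≃ ℚᵘ.mkℚᵘ (+ a) b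
    toℚᵘ-/ a b = ℚ.toℚᵘ-fromℚᵘ (ℚᵘ.mkℚᵘ (+ a) b)

  /-+-/ : ∀ a c b .{{_ : ℕ.NonZero b}} → (+ a / b) ℚ.+ (+ c / b) ≡ + (a + c) / b
  /-+-/ a c (suc b) = ℚ.toℚᵘ-injective (ℚᵘ.≃-trans (ℚ.toℚᵘ-homo-+ (+ a / B) (+ c / B))
    (ℚᵘ.≃-trans (ℚᵘ.+-cong (toℚᵘ-/ a b) (toℚᵘ-/ c b))
      (ℚᵘ.≃-trans (ℚᵘ.*≡* cross) (ℚᵘ.≃-sym (toℚᵘ-/ (a + c) b)))))
    where
    open ≡-Reasoning
    B = suc b
    cross : ((+ a) ℤ.* (+ B) ℤ.+ (+ c) ℤ.* (+ B)) ℤ.* (+ B) ≡ (+ (a + c)) ℤ.* (+ (B * B))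
    cross = begin
        ((+ a) ℤ.* (+ B) ℤ.+ (+ c) ℤ.* (+ B)) ℤ.* (+ B)
          ≡⟨ cong (ℤ._* (+ B)) (cong₂ ℤ._+_ (sym (ℤ.pos-* a B)) (sym (ℤ.pos-* c B))) ⟩
        (+ (a * B) ℤ.+ + (c * B)) ℤ.* (+ B)              ≡⟨ cong (ℤ._* (+ B)) (sym (ℤ.pos-+ (a * B) (c * B))) ⟩
        + (a * B + c * B) ℤ.* (+ B)                      ≡⟨ sym (ℤ.pos-* (a * B + c * B) B) ⟩
        + ((a * B + c * B) * B)                          ≡⟨ cong +_ (distribute a c B) ⟩
        + ((a + c) * (B * B))                            ≡⟨ ℤ.pos-* (a + c) (B * B) ⟩
        (+ (a + c)) ℤ.* (+ (B * B))                      ∎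
      where
      distribute : ∀ a c B → (a * B + c * B) * B ≡ (a + c) * (B * B)
      distribute = solve-∀

  /-*-/ : ∀ a b c d .{{_ : ℕ.NonZero b}} .{{_ : ℕ.NonZero d}} → (+ a / b) ℚ.* (+ c / d) ≡ (+ (a * c) / (b * d)) {{ℕ.m*n≢0 b d}}
  /-*-/ a (suc b) c (suc d) = ℚ.toℚᵘ-injective (ℚᵘ.≃-trans (ℚ.toℚᵘ-homo-* (+ a / suc b) (+ c / suc d))
    (ℚᵘ.≃-trans (ℚᵘ.*-cong (toℚᵘ-/ a b) (toℚᵘ-/ c d))
      (ℚᵘ.≃-trans (ℚᵘ.*≡* (cong (ℤ._* (+ suc (d + b * suc d))) (sym (ℤ.pos-* a c))))
        (ℚᵘ.≃-sym (toℚᵘ-/ (a * c) (d + b * suc d))))))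

  /-^Q : ∀ a b n .{{_ : ℕ.NonZero b}} → (+ a / b) ^Q n ≡ (+ (a ^ n) / (b ^ n)) {{ℕ.m^n≢0 b n}}
  /-^Q a b zero = refl
  /-^Q a b (suc n) {{b≢0}} = trans (cong ((+ a / b) ℚ.*_) (/-^Q a b n)) (/-*-/ a b (a ^ n) (b ^ n) {{b≢0}} {{ℕ.m^n≢0 b n}})

  sumQ-/ : ∀ {A : Set} (h : A → ℕ) D .{{_ : ℕ.NonZero D}} xs → sumQ (map (λ x → + h x / D) xs) ≡ + ∑ h xs / D
  sumQ-/ h D [] = /-cross 0 1 0 D refl
  sumQ-/ h D (x ∷ xs) = trans (cong ((+ h x / D) ℚ.+_) (sumQ-/ h D xs)) (/-+-/ (h x) (∑ h xs) D)

  /-÷-/ : ∀ a b N .{{_ : ℕ.NonZero b}} .{{_ : ℕ.NonZero N}} .{{_ : NonZero (+ b / N)}} → (+ a / N) ÷ (+ b / N) ≡ + a / b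
  /-÷-/ a b N = sym (begin
      + a / b                                      ≡⟨ sym (ℚ.*-identityʳ (+ a / b)) ⟩
      (+ a / b) ℚ.* 1ℚ                             ≡⟨ cong ((+ a / b) ℚ.*_) (sym (ℚ.*-inverseʳ (+ b / N))) ⟩
      (+ a / b) ℚ.* ((+ b / N) ℚ.* ℚ.1/ (+ b / N)) ≡⟨ sym (ℚ.*-assoc (+ a / b) (+ b / N) _) ⟩
      ((+ a / b) ℚ.* (+ b / N)) ℚ.* ℚ.1/ (+ b / N)
        ≡⟨ cong (ℚ._* ℚ.1/ (+ b / N)) (trans (/-*-/ a b b N) (/-cross (a * b) (b * N) a N {{ℕ.m*n≢0 b N}} (regroup a b N))) ⟩
      (+ a / N) ℚ.* ℚ.1/ (+ b / N)                 ∎)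
    where
    open ≡-Reasoning
    regroup : ∀ a b N → a * b * N ≡ a * (b * N)
    regroup = solve-∀

  -- v is replaced by v or by 1, so in all three polynomials t ∈ I₀₁₂,ₘ contributes this same coefficient.
  monomial : ℕ → List ℕ → ℚ
  monomial m t = (+ 1 / m !) {{m !≢0}} ℚ.* (ℚ.½ ^Q o m t) ℚ.* (1ℚ ^Q r m t) ℚ.* ((+ 2 / 1) ^Q m)

  o≤m : ∀ m t → o m t ≤ m
  o≤m m t = ≡-subst (o m t ≤_) (length-oneTo m) (List.length-filter _ (oneTo m))

  monomial≡ : ∀ m t → monomial m t ≡ (+ (2 ^ (m ∸ o m t)) / m !) {{m !≢0}}
  monomial≡ m t = begin
      monomial m t
        ≡⟨ cong₂ (λ u v → f₁ ℚ.* u ℚ.* v ℚ.* ((+ 2 / 1) ^Q m)) (/-^Q 1 2 O) (/-^Q 1 1 R) ⟩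
      f₁ ℚ.* f₂ ℚ.* f₃ ℚ.* ((+ 2 / 1) ^Q m)
        ≡⟨ cong (f₁ ℚ.* f₂ ℚ.* f₃ ℚ.*_) (/-^Q 2 1 m) ⟩
      f₁ ℚ.* f₂ ℚ.* f₃ ℚ.* f₄
        ≡⟨ cong (λ u → u ℚ.* f₃ ℚ.* f₄) (/-*-/ 1 (m !) (1 ^ O) (2 ^ O) {{m !≢0}} {{nz₂}}) ⟩
      (+ (1 * 1 ^ O) / (m ! * 2 ^ O)) {{nz₁₂}} ℚ.* f₃ ℚ.* f₄
        ≡⟨ cong (ℚ._* f₄) (/-*-/ (1 * 1 ^ O) (m ! * 2 ^ O) (1 ^ R) (1 ^ R) {{nz₁₂}} {{nz₃}}) ⟩
      (+ (1 * 1 ^ O * 1 ^ R) / (m ! * 2 ^ O * 1 ^ R)) {{nz₁₂₃}} ℚ.* f₄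
        ≡⟨ /-*-/ (1 * 1 ^ O * 1 ^ R) (m ! * 2 ^ O * 1 ^ R) (2 ^ m) (1 ^ m) {{nz₁₂₃}} {{nz₄}} ⟩
      (+ (1 * 1 ^ O * 1 ^ R * 2 ^ m) / (m ! * 2 ^ O * 1 ^ R * 1 ^ m)) {{nz₁₂₃₄}}
        ≡⟨ /-cross (1 * 1 ^ O * 1 ^ R * 2 ^ m) (m ! * 2 ^ O * 1 ^ R * 1 ^ m) (2 ^ (m ∸ O)) (m !) {{nz₁₂₃₄}} {{m !≢0}} cross ⟩
      (+ (2 ^ (m ∸ O)) / m !) {{m !≢0}} ∎
    where
    open ≡-Reasoning
    O = o m t
    R = r m t
    nz₂ = ℕ.m^n≢0 2 O
    nz₃ = ℕ.m^n≢0 1 R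
    nz₄ = ℕ.m^n≢0 1 m
    nz₁₂ = ℕ.m*n≢0 (m !) (2 ^ O) {{m !≢0}} {{nz₂}}
    nz₁₂₃ = ℕ.m*n≢0 (m ! * 2 ^ O) (1 ^ R) {{nz₁₂}} {{nz₃}}
    nz₁₂₃₄ = ℕ.m*n≢0 (m ! * 2 ^ O * 1 ^ R) (1 ^ m) {{nz₁₂₃}} {{nz₄}}
    f₁ = (+ 1 / m !) {{m !≢0}}
    f₂ = (+ (1 ^ O) / 2 ^ O) {{nz₂}}
    f₃ = (+ (1 ^ R) / 1 ^ R) {{nz₃}}
    f₄ = (+ (2 ^ m) / 1 ^ m) {{nz₄}}
    2^m≡ : 2 ^ m ≡ 2 ^ (m ∸ O) * 2 ^ O
    2^m≡ = trans (cong (2 ^_) (sym (ℕ.m∸n+n≡m (o≤m m t)))) (ℕ.^-distribˡ-+-* 2 (m ∸ O) O)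
    cross : 1 * 1 ^ O * 1 ^ R * 2 ^ m * m ! ≡ 2 ^ (m ∸ O) * (m ! * 2 ^ O * 1 ^ R * 1 ^ m)
    cross rewrite ℕ.^-zeroˡ O | ℕ.^-zeroˡ R | ℕ.^-zeroˡ m | 2^m≡ = regroup (2 ^ (m ∸ O)) (2 ^ O) (m !)
      where
      regroup : ∀ x y f → 1 * 1 * 1 * (x * y) * f ≡ x * (f * y * 1 * 1)
      regroup = solve-∀

  prob≡count/length : ∀ {A : Set} (xs : List A) E .{{_ : ℕ.NonZero (length xs)}} → prob xs E ≡ + count E xs / length xs
  prob≡count/length (_ ∷ _) E = refl

  prob-ρT : ∀ n B → prob (ρT (suc n)) B ≡ sumQ (map (λ t → if B t then monomial (suc n) t else 0ℚ) (I012 (suc n)))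
  prob-ρT n B = begin
      prob (ρT m) B
        ≡⟨ prob≡count/length (ρT m) B {{length-ρT-nonZero m}} ⟩
      (+ count B (ρT m) / length (ρT m)) {{length-ρT-nonZero m}}
        ≡⟨ /-cross (count B (ρT m)) (length (ρT m)) S (m !) {{length-ρT-nonZero m}} {{m !≢0}} cross ⟩
      (+ S / m !) {{m !≢0}}
        ≡⟨ sym (sumQ-/ (λ t → χ (B t) * 2 ^ (m ∸ o m t)) (m !) {{m !≢0}} (I012 m)) ⟩
      sumQ (map (λ t → (+ (χ (B t) * 2 ^ (m ∸ o m t)) / m !) {{m !≢0}}) (I012 m))
        ≡⟨ cong sumQ (List.map-cong summand (I012 m)) ⟩
      sumQ (map (λ t → if B t then monomial m t else 0ℚ) (I012 m)) ∎
    where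
    open ≡-Reasoning
    m = suc n
    S = ∑ (λ t → χ (B t) * 2 ^ (m ∸ o m t)) (I012 m)
    cross : count B (ρT m) * m ! ≡ S * length (ρT m)
    cross = ℕ.*-cancelˡ-≡ _ _ (2 ^ m) {{ℕ.m^n≢0 2 m}} (begin
        2 ^ m * (count B (ρT m) * m !)   ≡⟨ sym (ℕ.*-assoc (2 ^ m) _ (m !)) ⟩
        2 ^ m * count B (ρT m) * m !     ≡⟨ cong (_* m !) (count-ρT n B) ⟩
        suc m ! * S * m !                ≡⟨ regroup (suc m !) S (m !) ⟩
        S * (suc m ! * m !)              ≡⟨ cong (S *_) (sym (length-ρT m)) ⟩
        S * (2 ^ m * length (ρT m))      ≡⟨ *-CS.x∙yz≈y∙xz S (2 ^ m) _ ⟩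
        2 ^ m * (S * length (ρT m))      ∎)
      where
      regroup : ∀ f s g → f * s * g ≡ s * (f * g)
      regroup = solve-∀
    summand : ∀ t → (+ (χ (B t) * 2 ^ (m ∸ o m t)) / m !) {{m !≢0}} ≡ (if B t then monomial m t else 0ℚ)
    summand t with B t
    ... | true = trans (cong (λ n → (+ n / m !) {{m !≢0}}) (ℕ.*-identityˡ (2 ^ (m ∸ o m t)))) (sym (monomial≡ m t))
    ... | false = /-cross 0 (m !) 0 1 {{m !≢0}} refl

  coeff-Y : ∀ m a b e₁ e₂ → coeff a b 0 (subst (ℚ.½ , e₁) (1ℚ , e₂) (+ 2 / 1 , 0) (Y m)) ≡
    sumQ (map (λ t → if (a ≡ᵇ e₁ * o m t) ∧ (b ≡ᵇ e₂ * r m t) ∧ true then monomial m t else 0ℚ) (I012 m))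
  coeff-Y m a b e₁ e₂ = go (I012 m)
    where
    summand : List ℕ → ℚ
    summand t = if (a ≡ᵇ e₁ * o m t) ∧ (b ≡ᵇ e₂ * r m t) ∧ true then monomial m t else 0ℚ
    go : ∀ ts → coeff a b 0 (subst (ℚ.½ , e₁) (1ℚ , e₂) (+ 2 / 1 , 0) (map (λ t → ((+ 1 / m !) {{m !≢0}} , o m t , r m t , m)) ts))
                ≡ sumQ (map summand ts)
    go [] = refl
    go (t ∷ ts) = cong (summand t ℚ.+_) (go ts)

  sumQ-if-cong : ∀ {A : Set} {B B' : A → Bool} (f : A → ℚ) → (∀ x → B x ≡ B' x) → ∀ xs →
    sumQ (map (λ x → if B x then f x else 0ℚ) xs) ≡ sumQ (map (λ x → if B' x then f x else 0ℚ) xs)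
  sumQ-if-cong f B≗B' xs = cong sumQ (List.map-cong (λ x → cong (λ b → if b then f x else 0ℚ) (B≗B' x)) xs)

  P-r≡coeff : ∀ n r' → P-r (suc n) r' ≡ coeff 0 r' 0 (Y[1/2,v,2] (suc n))
  P-r≡coeff n r' = trans (prob-ρT n _) (sym (trans (coeff-Y (suc n) 0 r' 0 1)
    (sumQ-if-cong (monomial (suc n)) (λ t → trans (Bool.∧-identityʳ _) (≡ᵇ-1* (r (suc n) t) r')) (I012 (suc n)))))

  P-or≡coeff : ∀ n o' r' → P-or (suc n) o' r' ≡ coeff o' r' 0 (Y[x/2,v,2] (suc n))
  P-or≡coeff n o' r' = trans (prob-ρT n _) (sym (trans (coeff-Y (suc n) o' r' 1 1)
    (sumQ-if-cong (monomial (suc n)) event (I012 (suc n)))))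
    where
    event : ∀ t → ((o' ≡ᵇ 1 * o (suc n) t) ∧ (r' ≡ᵇ 1 * r (suc n) t) ∧ true) ≡ ((o (suc n) t ≡ᵇ o') ∧ (r (suc n) t ≡ᵇ r'))
    event t = cong₂ _∧_ (≡ᵇ-1* (o (suc n) t) o') (trans (Bool.∧-identityʳ _) (≡ᵇ-1* (r (suc n) t) r'))

  P-o≡coeff : ∀ n o' → P-o (suc n) o' ≡ coeff o' 0 0 (Y[x/2,1,2] (suc n))
  P-o≡coeff n o' = trans (prob-ρT n _) (sym (trans (coeff-Y (suc n) o' 0 1 0)
    (sumQ-if-cong (monomial (suc n)) (λ t → trans (Bool.∧-identityʳ _) (≡ᵇ-1* (o (suc n) t) o')) (I012 (suc n)))))

  ÷-cong : ∀ {x x' y y'} → x ≡ x' → y ≡ y' → (nz : NonZero y) (nz' : NonZero y') → (x ÷ y) {{nz}} ≡ (x' ÷ y') {{nz'}}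
  ÷-cong refl refl _ _ = refl

  count-nonZero : ∀ {A : Set} (xs : List A) F .{{_ : ℕ.NonZero (length xs)}} → 0ℚ < prob xs F → ℕ.NonZero (count F xs)
  count-nonZero xs F 0<P with count F xs | prob≡count/length xs F
  ... | zero | prob≡0/N = ⊥-elim (ℚ.<-irrefl refl (≡-subst (0ℚ <_) (trans prob≡0/N (/-cross 0 (length xs) 0 1 refl)) 0<P))
  ... | suc _ | _ = _

  condProb≡prob÷prob : ∀ {A : Set} (xs : List A) (F E : A → Bool) .{{_ : ℕ.NonZero (length xs)}} (0<P : 0ℚ < prob xs F) →
    condProb xs E F ≡ (prob xs (λ x → F x ∧ E x) ÷ prob xs F) {{ℚ.pos⇒nonZero (prob xs F) {{ℚ.positive 0<P}}}}
  condProb≡prob÷prob xs F E 0<P = begin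
      condProb xs E F
        ≡⟨ prob≡count/length (filter (λ x → F x Data.Bool.≟ true) xs) E {{count-F≢0}} ⟩
      (+ count E (filter (λ x → F x Data.Bool.≟ true) xs) / count F xs) {{count-F≢0}}
        ≡⟨ cong (λ c → (+ c / count F xs) {{count-F≢0}}) (count-filter F E xs) ⟩
      (+ count (λ x → F x ∧ E x) xs / count F xs) {{count-F≢0}}
        ≡⟨ sym (/-÷-/ (count (λ x → F x ∧ E x) xs) (count F xs) (length xs) {{count-F≢0}} {{it}} {{prob≢0′}}) ⟩
      ((+ count (λ x → F x ∧ E x) xs / length xs) ÷ (+ count F xs / length xs)) {{prob≢0′}}
        ≡⟨ ÷-cong (sym (prob≡count/length xs (λ x → F x ∧ E x))) (sym (prob≡count/length xs F)) prob≢0′ prob≢0 ⟩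
      (prob xs (λ x → F x ∧ E x) ÷ prob xs F) {{prob≢0}} ∎
    where
    open ≡-Reasoning
    count-F≢0 = count-nonZero xs F 0<P
    prob≢0 = ℚ.pos⇒nonZero (prob xs F) {{ℚ.positive 0<P}}
    prob≢0′ : NonZero (+ count F xs / length xs)
    prob≢0′ = ≡-subst NonZero (prob≡count/length xs F) prob≢0

  P-r∣o≡coeff÷coeff : ∀ n o' r' → 0ℚ < P-o (suc n) o' → Σ (NonZero (coeff o' 0 0 (Y[x/2,1,2] (suc n)))) (λ nz →
    P-r∣o (suc n) r' o' ≡ (coeff o' r' 0 (Y[x/2,v,2] (suc n)) ÷ coeff o' 0 0 (Y[x/2,1,2] (suc n))) {{nz}})
  P-r∣o≡coeff÷coeff n o' r' 0<P = coeff≢0 , trans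
    (condProb≡prob÷prob (ρT (suc n)) (λ t → o (suc n) t ≡ᵇ o') (λ t → r (suc n) t ≡ᵇ r') {{length-ρT-nonZero (suc n)}} 0<P)
    (÷-cong (P-or≡coeff n o' r') (P-o≡coeff n o') P≢0 coeff≢0)
    where
    P≢0 = ℚ.pos⇒nonZero (P-o (suc n) o') {{ℚ.positive 0<P}}
    coeff≢0 = ≡-subst NonZero (P-o≡coeff n o') P≢0

proposition4 : (m : ℕ) → 1 ≤ m →
    ((r' : ℕ) → P-r m r' ≡ coeff 0 r' 0 (Y[1/2,v,2] m))
    × ((o' r' : ℕ) → P-or m o' r' ≡ coeff o' r' 0 (Y[x/2,v,2] m))
    × ((o' r' : ℕ) → 0ℚ < P-o m o' →
        Σ (NonZero (coeff o' 0 0 (Y[x/2,1,2] m))) (λ nz →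
          P-r∣o m r' o' ≡ (coeff o' r' 0 (Y[x/2,v,2] m) ÷ coeff o' 0 0 (Y[x/2,1,2] m)) {{nz}}))
proposition4 (suc n) _ = P-r≡coeff n , P-or≡coeff n , P-r∣o≡coeff÷coeff n
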